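{- Let $p$ be a prime, $\mathcal H$ a definite quaternion algebra over $\mathbb Q$ of class number one which splits at $p$, and $\mathcal O$ a maximal order of $\mathcal H$. Let $(m,H)$ be a congruence pair of $\mathcal O$ with $p\nmid m$. Then $\mathcal G(\mathbb Z)$ and $\Lambda^p=\phi_m^{ -1}(H)$ are complementary subgroups of $\mathcal G(\mathbb Z[1/p])$, i.e. $\mathcal G(\mathbb Z)\cap\Lambda^p=\{1\}$ and $\mathcal G(\mathbb Z)\cdot\Lambda^p=\mathcal G(\mathbb Z[1/p])$.
   Context: Write $\mathcal O=\mathbb Z\oplus\mathbb Z\omega_1\oplus\mathbb Z\omega_2\oplus\mathbb Z\omega_3$. For a commutative ring $A$, $\mathcal G(A)=(\mathcal O\otimes A)^\times/A^\times$; $\mathcal G(\mathbb Z)=\mathcal O^\times/\{\pm1\}$ and $\mathcal G(\mathbb Z[1/p])\cong\{\gamma\in\mathcal O : N(\gamma)=p^k\}/\{\pm p^k:k\in\mathbb Z\}$ ($N$ the reduced norm). For a positive integer $m$, $\phi_m$ is the map to $\mathcal G(\mathbb Z/m\mathbb Z)$ induced by reducing the coordinates $w+x\omega_1+y\omega_2+z\omega_3\mapsto\bar w+\bar x\omega_1+\bar y\omega_2+\bar z\omega_3$ modulo $m$ (defined on $\mathcal G(\mathbb Z)$, and on $\mathcal G(\mathbb Z[1/p])$ when $p\nmid m$). A subgroup $K$ of a group $G$ is a right complement of a subgroup $L$ if $L\cap K=\{1\}$ and $L\cdot K=G$. A congruence pair of $\mathcal O$ is a pair $(m,H)$ with $m$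 a positive integer and $H\le\mathcal G(\mathbb Z/m\mathbb Z)$ such that $\phi_m$ is injective on $\mathcal G(\mathbb Z)$ and $H$ is a right complement of $\phi_m(\mathcal G(\mathbb Z))$ in $\mathcal G(\mathbb Z/m\mathbb Z)$. For $p\nmid m$, $\Lambda^p=\{\gamma\in\mathcal G(\mathbb Z[1/p]):\phi_m(\gamma)\in H\}$. -}

module Defs where

open import Data.Nat as ℕ using (ℕ)
open import Data.Integer as ℤ using (ℤ; +_; 0ℤ; 1ℤ)
open import Data.Integer.Divisibility as ℤD using ()
open import Data.Rational as ℚ using (ℚ)
open import Data.Fin using (Fin; zero; suc; inject₁)
open import Data.Vec using (Vec; []; _∷_)
open import Data.Product using (Σ; ∃; _×_; _,_)
open import Data.Sum using (_⊎_)
open import Relation.Nullary using (¬_)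
open import Relation.Binary.PropositionalEquality using (_≡_)

-- Vectors of length 4 (coordinates w.r.t. the Z-basis 1, ω₁, ω₂, ω₃ of 𝒪)

V4 : Set → Set
V4 A = Fin 4 → A

f0 f1 f2 f3 : Fin 4
f0 = zero
f1 = suc zero
f2 = suc (suc zero)
f3 = suc (suc (suc zero))

Σ4ℤ : (Fin 4 → ℤ) → ℤ
Σ4ℤ f = f f0 ℤ.+ f f1 ℤ.+ f f2 ℤ.+ f f3

Σ4ℚ : (Fin 4 → ℚ) → ℚ
Σ4ℚ f = f f0 ℚ.+ f f1 ℚ.+ f f2 ℚ.+ f f3

-- Structure constants of the order: ω_i ω_j = Σ_k c i j k ω_k, with ω₀ = 1.
StructConst : Set
StructConst = Fin 4 → Fin 4 → Fin 4 → ℤ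

module _ (c : StructConst) where

  mulℤ : V4 ℤ → V4 ℤ → V4 ℤ
  mulℤ x y k = Σ4ℤ λ i → Σ4ℤ λ j → x i ℤ.* y j ℤ.* c i j k

  -- multiplication in ℋ = 𝒪 ⊗ ℚ (rational coordinates)
  mulℚ : V4 ℚ → V4 ℚ → V4 ℚ
  mulℚ x y k = Σ4ℚ λ i → Σ4ℚ λ j → x i ℚ.* y j ℚ.* (c i j k ℚ./ 1)

oneℤ : V4 ℤ
oneℤ zero = 1ℤ
oneℤ (suc _) = 0ℤ

oneℚ : V4 ℚ
oneℚ zero = ℚ.1ℚ
oneℚ (suc _) = ℚ.0ℚ

zeroℤ : V4 ℤ
zeroℤ _ = 0ℤ

zeroℚ : V4 ℚ
zeroℚ _ = ℚ.0ℚ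

scaleℤ : ℤ → V4 ℤ → V4 ℤ
scaleℤ a x k = a ℤ.* x k

negℤ : V4 ℤ → V4 ℤ
negℤ x k = ℤ.- (x k)

scaleℚ : ℚ → V4 ℚ → V4 ℚ
scaleℚ a x k = a ℚ.* x k

addℚ : V4 ℚ → V4 ℚ → V4 ℚ
addℚ x y k = x k ℚ.+ y k

embed : V4 ℤ → V4 ℚ
embed x k = x k ℚ./ 1

_≐_ : {A : Set} → V4 A → V4 A → Set
x ≐ y = ∀ k → x k ≡ y k

InO : V4 ℚ → Set
InO v = ∃ λ (x : V4 ℤ) → embed x ≐ v

module _ (c : StructConst) where

  traceL : V4 ℤ → ℤ
  traceL x = Σ4ℤ λ k → mulℤ c x (λ j → if≡ j k) k
    where
    if≡ : Fin 4 → Fin 4 → ℤ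
    if≡ zero zero = 1ℤ
    if≡ zero (suc _) = 0ℤ
    if≡ (suc _) zero = 0ℤ
    if≡ (suc a) (suc b) = if≡' a b
      where
      if≡' : {n : ℕ} → Fin n → Fin n → ℤ
      if≡' zero zero = 1ℤ
      if≡' zero (suc _) = 0ℤ
      if≡' (suc _) zero = 0ℤ
      if≡' (suc a) (suc b) = if≡' a b

  -- reduced trace: trd(x) = tr(L_x)/2 (the regular trace is twice the reduced trace)
  trd : V4 ℤ → ℤ
  trd x = traceL x ℤ./ + 2

  -- reduced norm: x² − trd(x) x + nrd(x) = 0, so nrd(x)·1 = trd(x) x − x²
  nrd : V4 ℤ → ℤ
  nrd x = (trd x ℤ.* x f0) ℤ.- mulℤ c x x f0

det2 : ℤ → ℤ → ℤ → ℤ → ℤ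
det2 a b c d = a ℤ.* d ℤ.- b ℤ.* c

det3 : (Fin 3 → Fin 3 → ℤ) → ℤ
det3 M = M zero zero ℤ.* det2 (M (suc zero) (suc zero)) (M (suc zero) (suc (suc zero)))
                               (M (suc (suc zero)) (suc zero)) (M (suc (suc zero)) (suc (suc zero)))
       ℤ.- M zero (suc zero) ℤ.* det2 (M (suc zero) zero) (M (suc zero) (suc (suc zero)))
                                       (M (suc (suc zero)) zero) (M (suc (suc zero)) (suc (suc zero)))
       ℤ.+ M zero (suc (suc zero)) ℤ.* det2 (M (suc zero) zero) (M (suc zero) (suc zero))
                                             (M (suc (suc zero)) zero) (M (suc (suc zero)) (suc zero))

-- minor obtained by deleting row 0 and column j
minor : Fin 4 → (Fin 4 → Fin 4 → ℤ) → Fin 3 → Fin 3 → ℤ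
minor j M r s = M (suc r) (skip j s)
  where
  skip : Fin 4 → Fin 3 → Fin 4
  skip zero s = suc s
  skip (suc zero) zero = zero
  skip (suc zero) (suc s) = suc (suc s)
  skip (suc (suc zero)) zero = zero
  skip (suc (suc zero)) (suc zero) = suc zero
  skip (suc (suc zero)) (suc (suc s)) = suc (suc (suc s))
  skip (suc (suc (suc zero))) s = inject₁ s

det4 : (Fin 4 → Fin 4 → ℤ) → ℤ
det4 M = M f0 f0 ℤ.* det3 (minor f0 M) ℤ.- M f0 f1 ℤ.* det3 (minor f1 M)
       ℤ.+ M f0 f2 ℤ.* det3 (minor f2 M) ℤ.- M f0 f3 ℤ.* det3 (minor f3 M)

basisℤ : Fin 4 → V4 ℤ
basisℤ i = λ k → δ i k
  where
  δ : {n : ℕ} → Fin n → Fin n → ℤ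
  δ zero zero = 1ℤ
  δ zero (suc _) = 0ℤ
  δ (suc _) zero = 0ℤ
  δ (suc a) (suc b) = δ a b

disc : StructConst → ℤ
disc c = det4 λ i j → trd c (mulℤ c (basisℤ i) (basisℤ j))

lincomb : {n : ℕ} → Vec (V4 ℚ) n → Vec ℤ n → V4 ℚ
lincomb [] [] = zeroℚ
lincomb (g ∷ gs) (a ∷ as) = addℚ (scaleℚ (a ℚ./ 1) g) (lincomb gs as)

Span : {n : ℕ} → Vec (V4 ℚ) n → V4 ℚ → Set
Span {n} gs v = ∃ λ (as : Vec ℤ n) → lincomb gs as ≐ v

-- 𝒪 (given by structure constants with ω₀ = 1) is a unital associative ring
-- and ℋ = 𝒪 ⊗ ℚ is a quaternion algebra over ℚ: it has a ℚ-basis 1, i, j, ij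
-- with i² = a, j² = b, ji = −ij, a, b ∈ ℚ^×.
record IsQuaternionOrder (c : StructConst) : Set where
  field
    assoc   : ∀ x y z → mulℤ c (mulℤ c x y) z ≐ mulℤ c x (mulℤ c y z)
    unitˡ   : ∀ x → mulℤ c oneℤ x ≐ x
    unitʳ   : ∀ x → mulℤ c x oneℤ ≐ x
    quat    : Σ (V4 ℚ) λ i → Σ (V4 ℚ) λ j → Σ ℚ λ a → Σ ℚ λ b →
                ¬ (a ≡ ℚ.0ℚ) × ¬ (b ≡ ℚ.0ℚ)
              × mulℚ c i i ≐ scaleℚ a oneℚ
              × mulℚ c j j ≐ scaleℚ b oneℚ
              × mulℚ c j i ≐ scaleℚ (ℚ.- ℚ.1ℚ) (mulℚ c i j)
              × (∀ (r s t u : ℚ) →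
                   addℚ (scaleℚ r oneℚ) (addℚ (scaleℚ s i) (addℚ (scaleℚ t j) (scaleℚ u (mulℚ c i j))))
                     ≐ zeroℚ →
                   (r ≡ ℚ.0ℚ) × (s ≡ ℚ.0ℚ) × (t ≡ ℚ.0ℚ) × (u ≡ ℚ.0ℚ))

-- ℋ is definite: the reduced norm is positive definite
-- (equivalently ℋ ⊗ ℝ is a division algebra, i.e. ℋ ramifies at ∞).
IsDefinite : StructConst → Set
IsDefinite c = ∀ (x : V4 ℤ) → ¬ (x ≐ zeroℤ) → 0ℤ ℤ.< nrd c x

-- 𝒪 is a maximal order: every order of ℋ (subring of ℋ finitely generated as a
-- ℤ-module) containing 𝒪 equals 𝒪.
IsMaximalOrder : StructConst → Set
IsMaximalOrder c =
  ∀ (n : ℕ) (gs : Vec (V4 ℚ) n) →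
    (∀ (x : V4 ℤ) → Span gs (embed x)) →
    (∀ v w → Span gs v → Span gs w → Span gs (mulℚ c v w)) →
    ∀ v → Span gs v → InO v

-- Class number one: every left 𝒪-ideal (full ℤ-lattice I ⊂ ℋ with 𝒪 I ⊆ I)
-- is principal, I = 𝒪 α.
HasClassNumberOne : StructConst → Set
HasClassNumberOne c =
  ∀ (n : ℕ) (gs : Vec (V4 ℚ) n) →
    (Σ ℤ λ d → ¬ (d ≡ 0ℤ) × (∀ (x : V4 ℤ) → Span gs (embed (scaleℤ d x)))) →
    (∀ (x : V4 ℤ) v → Span gs v → Span gs (mulℚ c (embed x) v)) →
    ∃ λ (α : V4 ℚ) → ∀ v →
      (Span gs v → ∃ λ (x : V4 ℤ) → mulℚ c (embed x) α ≐ v)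
      × ((∃ λ (x : V4 ℤ) → mulℚ c (embed x) α ≐ v) → Span gs v)

-- ℋ splits at p: for the maximal order 𝒪, p does not divide disc(𝒪)
-- (the ramified primes of ℋ are exactly the primes dividing disc(𝒪)).
SplitsAt : StructConst → ℕ → Set
SplitsAt c p = ¬ ((+ p) ℤD.∣ disc c)

-- 𝒢(ℤ) = 𝒪^× / {±1}

module _ (c : StructConst) where

  IsUnitO : V4 ℤ → Set
  IsUnitO u = ∃ λ v → mulℤ c u v ≐ oneℤ × mulℤ c v u ≐ oneℤ

-- 𝒢(ℤ/mℤ) = (𝒪/m𝒪)^× / (ℤ/mℤ)^×, elements represented by integer vectors

_≡[_]_ : V4 ℤ → ℕ → V4 ℤ → Set
x ≡[ m ] y = ∀ k → (+ m) ℤD.∣ (x k ℤ.- y k)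

ScalarUnitMod : ℕ → ℤ → Set
ScalarUnitMod m a = ∃ λ b → (+ m) ℤD.∣ (a ℤ.* b ℤ.- 1ℤ)

module _ (c : StructConst) (m : ℕ) where

  IsUnitMod : V4 ℤ → Set
  IsUnitMod x = ∃ λ y → mulℤ c x y ≡[ m ] oneℤ × mulℤ c y x ≡[ m ] oneℤ

  -- equality in 𝒢(ℤ/mℤ): x and y differ by a scalar unit mod m
  _~m_ : V4 ℤ → V4 ℤ → Set
  x ~m y = ∃ λ a → ScalarUnitMod m a × x ≡[ m ] scaleℤ a y

  record IsSubgroupG (H : V4 ℤ → Set) : Set where
    field
      units    : ∀ x → H x → IsUnitMod x
      wellDef  : ∀ x y → H x → x ~m y → H y
      hasOne   : H oneℤ
      mulClos  : ∀ x y → H x → H y → H (mulℤ c x y)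
      invClos  : ∀ x y → H x → mulℤ c x y ≡[ m ] oneℤ → H y

  record IsCongruencePair (H : V4 ℤ → Set) : Set where
    field
      mPos       : 0 ℕ.< m
      subgroup   : IsSubgroupG H
      -- φ_m injective on 𝒢(ℤ) = 𝒪^×/{±1}
      injective  : ∀ u v → IsUnitO c u → IsUnitO c v → u ~m v →
                   (u ≐ v) ⊎ (u ≐ negℤ v)
      -- φ_m(𝒢(ℤ)) ∩ H = {1}
      trivInter  : ∀ u → IsUnitO c u → H u → u ~m oneℤ
      -- φ_m(𝒢(ℤ)) · H = 𝒢(ℤ/mℤ)
      product    : ∀ x → IsUnitMod x →
                   ∃ λ u → ∃ λ h → IsUnitO c u × H h × x ~m mulℤ c u h

-- 𝒢(ℤ[1/p]) ≅ {γ ∈ 𝒪 : nrd γ = p^k} / {±p^k}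

module _ (c : StructConst) (p : ℕ) where

  InGp : V4 ℤ → Set
  InGp γ = ∃ λ (k : ℕ) → nrd c γ ≡ + (p ℕ.^ k)

  -- equality in 𝒢(ℤ[1/p]): γ, δ differ by a factor ±p^k, k ∈ ℤ
  _≈p_ : V4 ℤ → V4 ℤ → Set
  γ ≈p δ = ∃ λ (s : ℕ) → ∃ λ (t : ℕ) →
             (scaleℤ (+ (p ℕ.^ s)) γ ≐ scaleℤ (+ (p ℕ.^ t)) δ)
           ⊎ (scaleℤ (+ (p ℕ.^ s)) γ ≐ negℤ (scaleℤ (+ (p ℕ.^ t)) δ))

  InGZ : V4 ℤ → Set
  InGZ γ = ∃ λ u → IsUnitO c u × γ ≈p u

  InΛ : (H : V4 ℤ → Set) → V4 ℤ → Set
  InΛ H γ = InGp γ × H γ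

{-# OPTIONS --safe #-}
-- Since p is invertible modulo m, reduction modulo m is defined on 𝒢(ℤ[1/p]) and both claims are
-- pulled back from the complement property of (m, H).  If γ ∈ 𝒢(ℤ) ∩ Λ^p, then φ_m(γ) lies in
-- φ_m(𝒢(ℤ)) ∩ H = 1, and φ_m is injective on 𝒢(ℤ).  If nrd γ = p^k, then γ is a unit modulo m with
-- inverse p^(-k) γ̄, so φ_m(γ) = φ_m(u) h with u ∈ 𝒪^× and h ∈ H; then δ = u⁻¹ γ has φ_m(δ) = h, and
-- nrd δ = p^k because definiteness forces nrd u = 1.
--
-- The algebraic input, γ γ̄ = γ̄ γ = nrd γ and multiplicativity of nrd, is proved in ℋ = 𝒪 ⊗ ℚ.
-- There 1, i, j, ij is a basis, and in these coordinates the product and the norm form of the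
-- quaternion algebra (a, b) are explicit polynomials, so both facts become polynomial identities.
module Submission where

open import Level using (0ℓ)
open import Algebra.Bundles using (CommutativeRing)
open import Algebra.Core using (Op₁; Op₂)
open import Algebra.Structures using (IsCommutativeRing)
import Algebra.Properties.CommutativeSemigroup as CommutativeSemigroupProperties
import Algebra.Properties.Group as GroupProperties
import Algebra.Properties.Ring as RingProperties
import Algebra.Properties.Semiring.Sum as SemiringSum
open import Data.Nat as ℕ using (ℕ; zero; suc; s≤s)
import Data.Nat.Properties as ℕP
open import Data.Nat.Coprimality using (Coprime; coprime-Bézout)
open import Data.Nat.Divisibility using (_∣_)
open import Data.Nat.GCD using (module Bézout)
open import Data.Nat.Primality using (Prime; prime⇒irreducible)
open import Data.Integer as ℤ using (ℤ; 0ℤ; 1ℤ)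
import Data.Integer.Properties as ℤP
open import Data.Integer.DivMod using (a≡a%n+[a/n]*n; n%d<d)
import Data.Integer.Divisibility as Unsigned
open import Data.Integer.Divisibility.Signed
  using (divides; ∣ᵤ⇒∣; ∣⇒∣ᵤ; ∣m∣n⇒∣m+n; ∣m⇒∣m*n; ∣n⇒∣m*n) renaming (_∣_ to _∣ℤ_)
open import Data.Integer.Tactic.RingSolver using (solve-∀)
open import Data.Rational as ℚ using (ℚ; 0ℚ; 1ℚ; 1/_)
import Data.Rational.Properties as ℚP
open import Data.Rational.Unnormalised as ℚᵘ using (mkℚᵘ; *≡*)
import Data.Rational.Unnormalised.Properties as ℚᵘP
open import Data.Fin as Fin using (Fin; zero; suc; punchIn; punchOut)
import Data.Fin.Properties as FinP
open import Data.Fin.Patterns using (0F; 1F; 2F; 3F)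
open import Data.Vec.Functional using (_∷_)
open import Data.Product as Product using (∃; _×_; _,_; proj₁; proj₂)
open import Data.Sum using (_⊎_; inj₁; inj₂)
open import Data.Empty using (⊥-elim)
open import Relation.Nullary using (¬_; yes; no; ¬?)
open import Relation.Nullary.Decidable using (decidable-stable; dec⇒maybe)
open import Relation.Binary.PropositionalEquality
import Tactic.RingSolver as RingSolver
open import Tactic.RingSolver.Core.AlmostCommutativeRing using (AlmostCommutativeRing; fromCommutativeRing)
open import Defs

module StructureConstants
  {A : Set} {plus times : Op₂ A} {minus : Op₁ A} {0# 1# : A}
  (isCommutativeRing : IsCommutativeRing _≡_ plus times minus 0# 1#) where

  infixl 6 _+_
  infixl 7 _*_
  infix  8 -_

  _+_ _*_ : Op₂ A
  _+_ = plus
  _*_ = times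

  -_ : Op₁ A
  -_ = minus

  ring : CommutativeRing 0ℓ 0ℓ
  ring = record { isCommutativeRing = isCommutativeRing }

  open CommutativeRing ring
    using (+-assoc; +-identityˡ; +-identityʳ; *-assoc; *-comm; *-identityˡ; distribˡ; distribʳ; zeroˡ;
           semiring; *-commutativeSemigroup)
  open RingProperties (CommutativeRing.ring ring) using (-‿distribˡ-*; -‿distribʳ-*; -‿+-comm)
  open SemiringSum semiring using (sum; sum-cong-≗; sum-replicate-zero; ∑-distrib-+; ∑-comm; *-distribˡ-sum)
  open CommutativeSemigroupProperties *-commutativeSemigroup using (interchange; xy∙z≈y∙xz; xy∙z≈zx∙y; x∙yz≈y∙xz)
  open ≡-Reasoning

  ∑₄ : (Fin 4 → A) → A
  ∑₄ f = f f0 + f f1 + f f2 + f f3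

  ∑₄-cong : ∀ {f g} → (∀ i → f i ≡ g i) → ∑₄ f ≡ ∑₄ g
  ∑₄-cong f≗g = cong₂ _+_ (cong₂ _+_ (cong₂ _+_ (f≗g f0) (f≗g f1)) (f≗g f2)) (f≗g f3)

  ∑₄≡sum : ∀ f → ∑₄ f ≡ sum f
  ∑₄≡sum f = begin
    f f0 + f f1 + f f2 + f f3               ≡⟨ cong (_+ f f3) (+-assoc _ _ _) ⟩
    f f0 + (f f1 + f f2) + f f3             ≡⟨ +-assoc _ _ _ ⟩
    f f0 + (f f1 + f f2 + f f3)             ≡⟨ cong (f f0 +_) (+-assoc _ _ _) ⟩
    f f0 + (f f1 + (f f2 + f f3))           ≡⟨ cong (λ s → f f0 + (f f1 + (f f2 + s))) (+-identityʳ _) ⟨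
    f f0 + (f f1 + (f f2 + (f f3 + 0#)))    ∎

  ∑₄-distrib-+ : ∀ f g → ∑₄ (λ i → f i + g i) ≡ ∑₄ f + ∑₄ g
  ∑₄-distrib-+ f g = begin
    ∑₄ (λ i → f i + g i)  ≡⟨ ∑₄≡sum (λ i → f i + g i) ⟩
    sum (λ i → f i + g i) ≡⟨ ∑-distrib-+ f g ⟩
    sum f + sum g         ≡⟨ cong₂ _+_ (∑₄≡sum f) (∑₄≡sum g) ⟨
    ∑₄ f + ∑₄ g           ∎

  ∑₄-comm : ∀ (f : Fin 4 → Fin 4 → A) → ∑₄ (λ i → ∑₄ (f i)) ≡ ∑₄ (λ j → ∑₄ (λ i → f i j))
  ∑₄-comm f = begin
    ∑₄ (λ i → ∑₄ (f i))            ≡⟨ ∑₄∑₄≡sum-sum f ⟩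
    sum (λ i → sum (f i))          ≡⟨ ∑-comm f ⟩
    sum (λ j → sum (λ i → f i j))  ≡⟨ ∑₄∑₄≡sum-sum (λ j i → f i j) ⟨
    ∑₄ (λ j → ∑₄ (λ i → f i j))    ∎
    where
    ∑₄∑₄≡sum-sum : ∀ g → ∑₄ (λ i → ∑₄ (g i)) ≡ sum (λ i → sum (g i))
    ∑₄∑₄≡sum-sum g = trans (∑₄≡sum (λ i → ∑₄ (g i))) (sum-cong-≗ (λ i → ∑₄≡sum (g i)))

  *-distribˡ-∑₄ : ∀ a f → a * ∑₄ f ≡ ∑₄ (λ i → a * f i)
  *-distribˡ-∑₄ a f = begin
    a * ∑₄ f                ≡⟨ cong (a *_) (∑₄≡sum f) ⟩
    a * sum f               ≡⟨ *-distribˡ-sum a f ⟩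
    sum (λ i → a * f i)     ≡⟨ ∑₄≡sum (λ i → a * f i) ⟨
    ∑₄ (λ i → a * f i)      ∎

  *-distribʳ-∑₄ : ∀ a f → ∑₄ f * a ≡ ∑₄ (λ i → f i * a)
  *-distribʳ-∑₄ a f = trans (*-comm _ a) (trans (*-distribˡ-∑₄ a f) (∑₄-cong (λ i → *-comm a (f i))))

  -‿distrib-∑₄ : ∀ f → - ∑₄ f ≡ ∑₄ (λ i → - f i)
  -‿distrib-∑₄ f = sym (begin
    - f f0 + - f f1 + - f f2 + - f f3   ≡⟨ cong (λ s → s + - f f2 + - f f3) (-‿+-comm _ _) ⟩
    - (f f0 + f f1) + - f f2 + - f f3   ≡⟨ cong (_+ - f f3) (-‿+-comm _ _) ⟩
    - (f f0 + f f1 + f f2) + - f f3     ≡⟨ -‿+-comm _ _ ⟩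
    - ∑₄ f                              ∎)

  δ : ∀ {n} → Fin n → Fin n → A
  δ zero    zero    = 1#
  δ zero    (suc _) = 0#
  δ (suc _) zero    = 0#
  δ (suc i) (suc j) = δ i j

  δ-sym : ∀ {n} (i j : Fin n) → δ i j ≡ δ j i
  δ-sym zero    zero    = refl
  δ-sym zero    (suc _) = refl
  δ-sym (suc _) zero    = refl
  δ-sym (suc i) (suc j) = δ-sym i j

  sum-δ : ∀ {n} i (f : Fin n → A) → sum (λ j → δ i j * f j) ≡ f i
  sum-δ {suc n} zero f = begin
    1# * f zero + sum {n} (λ j → 0# * f (suc j))
      ≡⟨ cong₂ _+_ (*-identityˡ _) (sum-cong-≗ (λ j → zeroˡ (f (suc j)))) ⟩
    f zero + sum {n} (λ _ → 0#)  ≡⟨ cong (f zero +_) (sum-replicate-zero n) ⟩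
    f zero + 0#                  ≡⟨ +-identityʳ _ ⟩
    f zero                       ∎
  sum-δ (suc i) f = begin
    0# * f zero + sum (λ j → δ i j * f (suc j))  ≡⟨ cong₂ _+_ (zeroˡ _) (sum-δ i (λ j → f (suc j))) ⟩
    0# + f (suc i)                               ≡⟨ +-identityˡ _ ⟩
    f (suc i)                                    ∎

  ∑₄-δ : ∀ i f → ∑₄ (λ j → δ i j * f j) ≡ f i
  ∑₄-δ i f = trans (∑₄≡sum (λ j → δ i j * f j)) (sum-δ i f)

  infixl 6 _⊕_
  infixr 7 _•_
  infix  8 ⊝_

  _⊕_ : V4 A → V4 A → V4 A
  (x ⊕ y) k = x k + y k

  _•_ : A → V4 A → V4 A
  (a • x) k = a * x k

  ⊝_ : V4 A → V4 A
  (⊝ x) k = - x k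

  ∑ᵛ : (Fin 4 → A) → (Fin 4 → V4 A) → V4 A
  ∑ᵛ q v k = ∑₄ λ α → q α * v α k

  module Algebra (C : Fin 4 → Fin 4 → Fin 4 → A) where

    infixl 7 _∙_

    _∙_ : V4 A → V4 A → V4 A
    (x ∙ y) k = ∑₄ λ i → ∑₄ λ j → x i * y j * C i j k

    e : Fin 4 → V4 A
    e = δ

    tr : V4 A → A
    tr x = ∑₄ λ k → (x ∙ e k) k

    ∙-congˡ : ∀ {x x′} y → x ≐ x′ → (x ∙ y) ≐ (x′ ∙ y)
    ∙-congˡ y x≐x′ k = ∑₄-cong λ i → ∑₄-cong λ j → cong (λ u → u * y j * C i j k) (x≐x′ i)

    ∙-congʳ : ∀ x {y y′} → y ≐ y′ → (x ∙ y) ≐ (x ∙ y′)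
    ∙-congʳ x y≐y′ k = ∑₄-cong λ i → ∑₄-cong λ j → cong (λ v → x i * v * C i j k) (y≐y′ j)

    e-∙ : ∀ a y k → (e a ∙ y) k ≡ ∑₄ λ j → y j * C a j k
    e-∙ a y k = begin
      ∑₄ (λ i → ∑₄ λ j → δ a i * y j * C i j k)    ≡⟨ ∑₄-cong (λ i → ∑₄-cong λ j → *-assoc (δ a i) (y j) (C i j k)) ⟩
      ∑₄ (λ i → ∑₄ λ j → δ a i * (y j * C i j k))  ≡⟨ ∑₄-cong (λ i → *-distribˡ-∑₄ (δ a i) (λ j → y j * C i j k)) ⟨
      ∑₄ (λ i → δ a i * ∑₄ λ j → y j * C i j k)    ≡⟨ ∑₄-δ a (λ i → ∑₄ λ j → y j * C i j k) ⟩
      ∑₄ (λ j → y j * C a j k)                     ∎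

    ∙-e : ∀ x b k → (x ∙ e b) k ≡ ∑₄ λ i → x i * C i b k
    ∙-e x b k = ∑₄-cong λ i → begin
      ∑₄ (λ j → x i * δ b j * C i j k)    ≡⟨ ∑₄-cong (λ j → xy∙z≈y∙xz (x i) (δ b j) (C i j k)) ⟩
      ∑₄ (λ j → δ b j * (x i * C i j k))  ≡⟨ ∑₄-δ b (λ j → x i * C i j k) ⟩
      x i * C i b k                       ∎

    ∙-columns : ∀ x y k → (x ∙ y) k ≡ ∑₄ λ j → y j * (x ∙ e j) k
    ∙-columns x y k = begin
      ∑₄ (λ i → ∑₄ λ j → x i * y j * C i j k)    ≡⟨ ∑₄-comm (λ i j → x i * y j * C i j k) ⟩
      ∑₄ (λ j → ∑₄ λ i → x i * y j * C i j k)    ≡⟨ ∑₄-cong (λ j → ∑₄-cong λ i → xy∙z≈y∙xz (x i) (y j) (C i j k)) ⟩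
      ∑₄ (λ j → ∑₄ λ i → y j * (x i * C i j k))  ≡⟨ ∑₄-cong (λ j → *-distribˡ-∑₄ (y j) λ i → x i * C i j k) ⟨
      ∑₄ (λ j → y j * ∑₄ λ i → x i * C i j k)    ≡⟨ ∑₄-cong (λ j → cong (y j *_) (∙-e x j k)) ⟨
      ∑₄ (λ j → y j * (x ∙ e j) k)               ∎

    e-∙-e : ∀ a b k → (e a ∙ e b) k ≡ C a b k
    e-∙-e a b k = begin
      (e a ∙ e b) k              ≡⟨ e-∙ a (e b) k ⟩
      ∑₄ (λ j → δ b j * C a j k) ≡⟨ ∑₄-δ b (λ j → C a j k) ⟩
      C a b k                    ∎

    ∙-distribʳ-⊕ : ∀ x y z → ((x ⊕ y) ∙ z) ≐ (x ∙ z ⊕ y ∙ z)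
    ∙-distribʳ-⊕ x y z k = begin
      ∑₄ (λ i → ∑₄ λ j → (x i + y i) * z j * C i j k)
        ≡⟨ ∑₄-cong (λ i → ∑₄-cong λ j → trans (cong (_* C i j k) (distribʳ (z j) (x i) (y i))) (distribʳ (C i j k) _ _)) ⟩
      ∑₄ (λ i → ∑₄ λ j → x i * z j * C i j k + y i * z j * C i j k)
        ≡⟨ ∑₄-cong (λ i → ∑₄-distrib-+ (λ j → x i * z j * C i j k) (λ j → y i * z j * C i j k)) ⟩
      ∑₄ (λ i → ∑₄ (λ j → x i * z j * C i j k) + ∑₄ (λ j → y i * z j * C i j k))
        ≡⟨ ∑₄-distrib-+ (λ i → ∑₄ λ j → x i * z j * C i j k) (λ i → ∑₄ λ j → y i * z j * C i j k) ⟩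
      (x ∙ z) k + (y ∙ z) k ∎

    ∙-distribˡ-⊕ : ∀ x y z → (x ∙ (y ⊕ z)) ≐ (x ∙ y ⊕ x ∙ z)
    ∙-distribˡ-⊕ x y z k = begin
      ∑₄ (λ i → ∑₄ λ j → x i * (y j + z j) * C i j k)
        ≡⟨ ∑₄-cong (λ i → ∑₄-cong λ j → trans (cong (_* C i j k) (distribˡ (x i) (y j) (z j))) (distribʳ (C i j k) _ _)) ⟩
      ∑₄ (λ i → ∑₄ λ j → x i * y j * C i j k + x i * z j * C i j k)
        ≡⟨ ∑₄-cong (λ i → ∑₄-distrib-+ (λ j → x i * y j * C i j k) (λ j → x i * z j * C i j k)) ⟩
      ∑₄ (λ i → ∑₄ (λ j → x i * y j * C i j k) + ∑₄ (λ j → x i * z j * C i j k))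
        ≡⟨ ∑₄-distrib-+ (λ i → ∑₄ λ j → x i * y j * C i j k) (λ i → ∑₄ λ j → x i * z j * C i j k) ⟩
      (x ∙ y) k + (x ∙ z) k ∎

    ∑∑-*-factor : ∀ a x y k → ∑₄ (λ i → ∑₄ λ j → a * (x i * y j * C i j k)) ≡ a * (x ∙ y) k
    ∑∑-*-factor a x y k =
      trans (∑₄-cong λ i → sym (*-distribˡ-∑₄ a λ j → x i * y j * C i j k))
            (sym (*-distribˡ-∑₄ a λ i → ∑₄ λ j → x i * y j * C i j k))

    ∑∑-neg-factor : ∀ x y k → ∑₄ (λ i → ∑₄ λ j → - (x i * y j * C i j k)) ≡ - (x ∙ y) k
    ∑∑-neg-factor x y k =
      trans (∑₄-cong λ i → sym (-‿distrib-∑₄ λ j → x i * y j * C i j k))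
            (sym (-‿distrib-∑₄ λ i → ∑₄ λ j → x i * y j * C i j k))

    ∙-scaleˡ : ∀ a x y → ((a • x) ∙ y) ≐ (a • (x ∙ y))
    ∙-scaleˡ a x y k = trans
      (∑₄-cong λ i → ∑₄-cong λ j → trans (cong (_* C i j k) (*-assoc a (x i) (y j))) (*-assoc a (x i * y j) (C i j k)))
      (∑∑-*-factor a x y k)

    ∙-scaleʳ : ∀ a x y → (x ∙ (a • y)) ≐ (a • (x ∙ y))
    ∙-scaleʳ a x y k = trans
      (∑₄-cong λ i → ∑₄-cong λ j → trans (cong (_* C i j k) (x∙yz≈y∙xz (x i) a (y j))) (*-assoc a (x i * y j) (C i j k)))
      (∑∑-*-factor a x y k)

    ∙-negˡ : ∀ x y → ((⊝ x) ∙ y) ≐ (⊝ (x ∙ y))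
    ∙-negˡ x y k = trans
      (∑₄-cong λ i → ∑₄-cong λ j → trans (cong (_* C i j k) (sym (-‿distribˡ-* (x i) (y j)))) (sym (-‿distribˡ-* _ _)))
      (∑∑-neg-factor x y k)

    ∙-negʳ : ∀ x y → (x ∙ (⊝ y)) ≐ (⊝ (x ∙ y))
    ∙-negʳ x y k = trans
      (∑₄-cong λ i → ∑₄-cong λ j → trans (cong (_* C i j k) (sym (-‿distribʳ-* (x i) (y j)))) (sym (-‿distribˡ-* _ _)))
      (∑∑-neg-factor x y k)

    ∙-∑ᵛˡ : ∀ q v y → (∑ᵛ q v ∙ y) ≐ ∑ᵛ q (λ α → v α ∙ y)
    ∙-∑ᵛˡ q v y k = begin
      (∑ᵛ q v ∙ y) k
        ≡⟨ ∙-distribʳ-⊕ (t f0 ⊕ t f1 ⊕ t f2) (t f3) y k ⟩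
      ((t f0 ⊕ t f1 ⊕ t f2) ∙ y) k + (t f3 ∙ y) k
        ≡⟨ cong (_+ (t f3 ∙ y) k) (∙-distribʳ-⊕ (t f0 ⊕ t f1) (t f2) y k) ⟩
      ((t f0 ⊕ t f1) ∙ y) k + (t f2 ∙ y) k + (t f3 ∙ y) k
        ≡⟨ cong (λ s → s + (t f2 ∙ y) k + (t f3 ∙ y) k) (∙-distribʳ-⊕ (t f0) (t f1) y k) ⟩
      (t f0 ∙ y) k + (t f1 ∙ y) k + (t f2 ∙ y) k + (t f3 ∙ y) k
        ≡⟨ ∑₄-cong (λ α → ∙-scaleˡ (q α) (v α) y k) ⟩
      ∑ᵛ q (λ α → v α ∙ y) k ∎
      where
      t : Fin 4 → V4 A
      t α = q α • v α

    ∙-∑ᵛʳ : ∀ q v x → (x ∙ ∑ᵛ q v) ≐ ∑ᵛ q (λ α → x ∙ v α)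
    ∙-∑ᵛʳ q v x k = begin
      (x ∙ ∑ᵛ q v) k
        ≡⟨ ∙-distribˡ-⊕ x (t f0 ⊕ t f1 ⊕ t f2) (t f3) k ⟩
      (x ∙ (t f0 ⊕ t f1 ⊕ t f2)) k + (x ∙ t f3) k
        ≡⟨ cong (_+ (x ∙ t f3) k) (∙-distribˡ-⊕ x (t f0 ⊕ t f1) (t f2) k) ⟩
      (x ∙ (t f0 ⊕ t f1)) k + (x ∙ t f2) k + (x ∙ t f3) k
        ≡⟨ cong (λ s → s + (x ∙ t f2) k + (x ∙ t f3) k) (∙-distribˡ-⊕ x (t f0) (t f1) k) ⟩
      (x ∙ t f0) k + (x ∙ t f1) k + (x ∙ t f2) k + (x ∙ t f3) k
        ≡⟨ ∑₄-cong (λ α → ∙-scaleʳ (q α) x (v α) k) ⟩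
      ∑ᵛ q (λ α → x ∙ v α) k ∎
      where
      t : Fin 4 → V4 A
      t α = q α • v α

    tr-cong : ∀ {x y} → x ≐ y → tr x ≡ tr y
    tr-cong x≐y = ∑₄-cong λ k → ∙-congˡ (e k) x≐y k

    tr-⊕ : ∀ x y → tr (x ⊕ y) ≡ tr x + tr y
    tr-⊕ x y = trans (∑₄-cong λ k → ∙-distribʳ-⊕ x y (e k) k) (∑₄-distrib-+ (λ k → (x ∙ e k) k) (λ k → (y ∙ e k) k))

    tr-• : ∀ a x → tr (a • x) ≡ a * tr x
    tr-• a x = trans (∑₄-cong λ k → ∙-scaleˡ a x (e k) k) (sym (*-distribˡ-∑₄ a λ k → (x ∙ e k) k))

    tr-⊝ : ∀ x → tr (⊝ x) ≡ - tr x
    tr-⊝ x = trans (∑₄-cong λ k → ∙-negˡ x (e k) k) (sym (-‿distrib-∑₄ λ k → (x ∙ e k) k))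

    tr-∑ᵛ : ∀ q v → tr (∑ᵛ q v) ≡ ∑₄ λ α → q α * tr (v α)
    tr-∑ᵛ q v = begin
      ∑₄ (λ k → (∑ᵛ q v ∙ e k) k)                 ≡⟨ ∑₄-cong (λ k → ∙-∑ᵛˡ q v (e k) k) ⟩
      ∑₄ (λ k → ∑₄ λ α → q α * (v α ∙ e k) k)     ≡⟨ ∑₄-comm (λ k α → q α * (v α ∙ e k) k) ⟩
      ∑₄ (λ α → ∑₄ λ k → q α * (v α ∙ e k) k)     ≡⟨ ∑₄-cong (λ α → *-distribˡ-∑₄ (q α) λ k → (v α ∙ e k) k) ⟨
      ∑₄ (λ α → q α * tr (v α))                   ∎

    Associative : Set
    Associative = ∀ x y z → ((x ∙ y) ∙ z) ≐ (x ∙ (y ∙ z))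

    AssociativeConstants : Set
    AssociativeConstants = ∀ a b c k → ∑₄ (λ l → C a b l * C l c k) ≡ ∑₄ (λ l → C b c l * C a l k)

    assoc⇒assoc-constants : Associative → AssociativeConstants
    assoc⇒assoc-constants assoc a b c k = begin
      ∑₄ (λ l → C a b l * C l c k)              ≡⟨ ∑₄-cong (λ l → cong (_* C l c k) (e-∙-e a b l)) ⟨
      ∑₄ (λ l → (e a ∙ e b) l * C l c k)        ≡⟨ ∙-e (e a ∙ e b) c k ⟨
      ((e a ∙ e b) ∙ e c) k                     ≡⟨ assoc (e a) (e b) (e c) k ⟩
      (e a ∙ (e b ∙ e c)) k                     ≡⟨ e-∙ a (e b ∙ e c) k ⟩
      ∑₄ (λ l → (e b ∙ e c) l * C a l k)        ≡⟨ ∑₄-cong (λ l → cong (_* C a l k) (e-∙-e b c l)) ⟩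
      ∑₄ (λ l → C b c l * C a l k)              ∎

    ∙-∙-expandˡ : ∀ x y z k → ((x ∙ y) ∙ z) k ≡
      ∑₄ λ a → ∑₄ λ b → ∑₄ λ c → x a * y b * z c * ∑₄ λ l → C a b l * C l c k
    ∙-∙-expandˡ x y z k = begin
      ∑₄ (λ l → ∑₄ λ c → (x ∙ y) l * z c * C l c k)
        ≡⟨ ∑₄-cong (λ l → ∑₄-cong λ c → trans (*-assoc _ (z c) (C l c k)) (expand l c)) ⟩
      ∑₄ (λ l → ∑₄ λ c → ∑₄ λ a → ∑₄ λ b → F a b c l)
        ≡⟨ ∑₄-cong (λ l → trans (∑₄-comm λ c a → ∑₄ λ b → F a b c l) (∑₄-cong λ a → ∑₄-comm λ c b → F a b c l)) ⟩
      ∑₄ (λ l → ∑₄ λ a → ∑₄ λ b → ∑₄ λ c → F a b c l)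
        ≡⟨ ∑₄-comm (λ l a → ∑₄ λ b → ∑₄ λ c → F a b c l) ⟩
      ∑₄ (λ a → ∑₄ λ l → ∑₄ λ b → ∑₄ λ c → F a b c l)
        ≡⟨ ∑₄-cong (λ a → trans (∑₄-comm λ l b → ∑₄ λ c → F a b c l) (∑₄-cong λ b → ∑₄-comm λ l c → F a b c l)) ⟩
      ∑₄ (λ a → ∑₄ λ b → ∑₄ λ c → ∑₄ λ l → F a b c l)
        ≡⟨ ∑₄-cong (λ a → ∑₄-cong λ b → ∑₄-cong λ c → sym (*-distribˡ-∑₄ (x a * y b * z c) λ l → C a b l * C l c k)) ⟩
      ∑₄ (λ a → ∑₄ λ b → ∑₄ λ c → x a * y b * z c * ∑₄ λ l → C a b l * C l c k) ∎
      where
      F : Fin 4 → Fin 4 → Fin 4 → Fin 4 → A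
      F a b c l = x a * y b * z c * (C a b l * C l c k)
      expand : ∀ l c → (x ∙ y) l * (z c * C l c k) ≡ ∑₄ λ a → ∑₄ λ b → F a b c l
      expand l c = begin
        (x ∙ y) l * w                                       ≡⟨ *-distribʳ-∑₄ w (λ a → ∑₄ λ b → x a * y b * C a b l) ⟩
        ∑₄ (λ a → (∑₄ λ b → x a * y b * C a b l) * w)       ≡⟨ ∑₄-cong (λ a → *-distribʳ-∑₄ w λ b → x a * y b * C a b l) ⟩
        ∑₄ (λ a → ∑₄ λ b → x a * y b * C a b l * w)
          ≡⟨ ∑₄-cong (λ a → ∑₄-cong λ b → interchange (x a * y b) (C a b l) (z c) (C l c k)) ⟩
        ∑₄ (λ a → ∑₄ λ b → F a b c l)                       ∎
        where
        w : A
        w = z c * C l c k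

    ∙-∙-expandʳ : ∀ x y z k → (x ∙ (y ∙ z)) k ≡
      ∑₄ λ a → ∑₄ λ b → ∑₄ λ c → x a * y b * z c * ∑₄ λ l → C b c l * C a l k
    ∙-∙-expandʳ x y z k = begin
      ∑₄ (λ a → ∑₄ λ l → x a * (y ∙ z) l * C a l k)
        ≡⟨ ∑₄-cong (λ a → ∑₄-cong λ l → expand a l) ⟩
      ∑₄ (λ a → ∑₄ λ l → ∑₄ λ b → ∑₄ λ c → F a b c l)
        ≡⟨ ∑₄-cong (λ a → trans (∑₄-comm λ l b → ∑₄ λ c → F a b c l) (∑₄-cong λ b → ∑₄-comm λ l c → F a b c l)) ⟩
      ∑₄ (λ a → ∑₄ λ b → ∑₄ λ c → ∑₄ λ l → F a b c l)
        ≡⟨ ∑₄-cong (λ a → ∑₄-cong λ b → ∑₄-cong λ c → sym (*-distribˡ-∑₄ (x a * y b * z c) λ l → C b c l * C a l k)) ⟩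
      ∑₄ (λ a → ∑₄ λ b → ∑₄ λ c → x a * y b * z c * ∑₄ λ l → C b c l * C a l k) ∎
      where
      F : Fin 4 → Fin 4 → Fin 4 → Fin 4 → A
      F a b c l = x a * y b * z c * (C b c l * C a l k)
      expand : ∀ a l → x a * (y ∙ z) l * C a l k ≡ ∑₄ λ b → ∑₄ λ c → F a b c l
      expand a l = begin
        x a * (y ∙ z) l * C a l k                           ≡⟨ xy∙z≈y∙xz (x a) ((y ∙ z) l) (C a l k) ⟩
        (y ∙ z) l * w                                       ≡⟨ *-distribʳ-∑₄ w (λ b → ∑₄ λ c → y b * z c * C b c l) ⟩
        ∑₄ (λ b → (∑₄ λ c → y b * z c * C b c l) * w)       ≡⟨ ∑₄-cong (λ b → *-distribʳ-∑₄ w λ c → y b * z c * C b c l) ⟩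
        ∑₄ (λ b → ∑₄ λ c → y b * z c * C b c l * w)
          ≡⟨ ∑₄-cong (λ b → ∑₄-cong λ c → trans (interchange (y b * z c) (C b c l) (x a) (C a l k))
                                                 (cong (_* (C b c l * C a l k)) (xy∙z≈zx∙y (y b) (z c) (x a)))) ⟩
        ∑₄ (λ b → ∑₄ λ c → F a b c l)                       ∎
        where
        w : A
        w = x a * C a l k

    assoc-constants⇒assoc : AssociativeConstants → Associative
    assoc-constants⇒assoc assoc x y z k = begin
      ((x ∙ y) ∙ z) k
        ≡⟨ ∙-∙-expandˡ x y z k ⟩
      ∑₄ (λ a → ∑₄ λ b → ∑₄ λ c → x a * y b * z c * ∑₄ λ l → C a b l * C l c k)
        ≡⟨ ∑₄-cong (λ a → ∑₄-cong λ b → ∑₄-cong λ c → cong (x a * y b * z c *_) (assoc a b c k)) ⟩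
      ∑₄ (λ a → ∑₄ λ b → ∑₄ λ c → x a * y b * z c * ∑₄ λ l → C b c l * C a l k)
        ≡⟨ ∙-∙-expandʳ x y z k ⟨
      (x ∙ (y ∙ z)) k ∎

    tr-comm : Associative → ∀ x y → tr (x ∙ y) ≡ tr (y ∙ x)
    tr-comm assoc x y = begin
      ∑₄ (λ k → ((x ∙ y) ∙ e k) k)                  ≡⟨ ∑₄-cong (λ k → trans (assoc x y (e k) k) (∙-columns x (y ∙ e k) k)) ⟩
      ∑₄ (λ k → ∑₄ λ l → (y ∙ e k) l * (x ∙ e l) k) ≡⟨ ∑₄-comm (λ k l → (y ∙ e k) l * (x ∙ e l) k) ⟩
      ∑₄ (λ l → ∑₄ λ k → (y ∙ e k) l * (x ∙ e l) k) ≡⟨ ∑₄-cong (λ l → ∑₄-cong λ k → *-comm ((y ∙ e k) l) ((x ∙ e l) k)) ⟩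
      ∑₄ (λ l → ∑₄ λ k → (x ∙ e l) k * (y ∙ e k) l) ≡⟨ ∑₄-cong (λ l → trans (assoc y x (e l) l) (∙-columns y (x ∙ e l) l)) ⟨
      ∑₄ (λ l → ((y ∙ x) ∙ e l) l)                  ∎

    Identityˡ : Set
    Identityˡ = ∀ y → (e f0 ∙ y) ≐ y

    Identityʳ : Set
    Identityʳ = ∀ x → (x ∙ e f0) ≐ x

    IdentityConstantsˡ : Set
    IdentityConstantsˡ = ∀ b k → C f0 b k ≡ δ b k

    IdentityConstantsʳ : Set
    IdentityConstantsʳ = ∀ a k → C a f0 k ≡ δ a k

    identityˡ⇒constants : Identityˡ → IdentityConstantsˡ
    identityˡ⇒constants identityˡ b k = trans (sym (e-∙-e f0 b k)) (identityˡ (e b) k)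

    identityʳ⇒constants : Identityʳ → IdentityConstantsʳ
    identityʳ⇒constants identityʳ a k = trans (sym (e-∙-e a f0 k)) (identityʳ (e a) k)

    constants⇒identityˡ : IdentityConstantsˡ → Identityˡ
    constants⇒identityˡ identity y k = begin
      (e f0 ∙ y) k               ≡⟨ e-∙ f0 y k ⟩
      ∑₄ (λ j → y j * C f0 j k)  ≡⟨ ∑₄-cong (λ j → trans (cong (y j *_) (trans (identity j k) (δ-sym j k))) (*-comm (y j) (δ k j))) ⟩
      ∑₄ (λ j → δ k j * y j)     ≡⟨ ∑₄-δ k y ⟩
      y k                        ∎

    constants⇒identityʳ : IdentityConstantsʳ → Identityʳ
    constants⇒identityʳ identity x k = begin
      (x ∙ e f0) k               ≡⟨ ∙-e x f0 k ⟩
      ∑₄ (λ i → x i * C i f0 k)  ≡⟨ ∑₄-cong (λ i → trans (cong (x i *_) (trans (identity i k) (δ-sym i k))) (*-comm (x i) (δ k i))) ⟩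
      ∑₄ (λ i → δ k i * x i)     ≡⟨ ∑₄-δ k x ⟩
      x k                        ∎

    tr-e₀ : Identityˡ → tr (e f0) ≡ 1# + 1# + 1# + 1#
    tr-e₀ identityˡ = ∑₄-cong λ k → identityˡ (e k) k

module Rationals where

  open import Data.Rational using (_+_; _*_; -_)

  fromℤ : ℤ → ℚ
  fromℤ i = i ℚ./ 1

  private
    fromℤ≃ : ∀ i → ℚ.toℚᵘ (fromℤ i) ℚᵘ.≃ mkℚᵘ i 0
    fromℤ≃ i = ℚP.toℚᵘ-fromℚᵘ (mkℚᵘ i 0)

  fromℤ-+ : ∀ i j → fromℤ (i ℤ.+ j) ≡ fromℤ i + fromℤ j
  fromℤ-+ i j = ℚP.toℚᵘ-injective (begin-equality
    ℚ.toℚᵘ (fromℤ (i ℤ.+ j))                    ≃⟨ fromℤ≃ (i ℤ.+ j) ⟩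
    mkℚᵘ (i ℤ.+ j) 0
      ≃⟨ *≡* (cong₂ (λ a b → (a ℤ.+ b) ℤ.* ℤ.+ 1) (sym (ℤP.*-identityʳ i)) (sym (ℤP.*-identityʳ j))) ⟩
    mkℚᵘ i 0 ℚᵘ.+ mkℚᵘ j 0                      ≃⟨ ℚᵘP.+-cong (fromℤ≃ i) (fromℤ≃ j) ⟨
    ℚ.toℚᵘ (fromℤ i) ℚᵘ.+ ℚ.toℚᵘ (fromℤ j)      ≃⟨ ℚP.toℚᵘ-homo-+ (fromℤ i) (fromℤ j) ⟨
    ℚ.toℚᵘ (fromℤ i + fromℤ j)                  ∎)
    where open ℚᵘP.≤-Reasoning

  fromℤ-* : ∀ i j → fromℤ (i ℤ.* j) ≡ fromℤ i * fromℤ j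
  fromℤ-* i j = ℚP.toℚᵘ-injective (begin-equality
    ℚ.toℚᵘ (fromℤ (i ℤ.* j))                    ≃⟨ fromℤ≃ (i ℤ.* j) ⟩
    mkℚᵘ i 0 ℚᵘ.* mkℚᵘ j 0                      ≃⟨ ℚᵘP.*-cong (fromℤ≃ i) (fromℤ≃ j) ⟨
    ℚ.toℚᵘ (fromℤ i) ℚᵘ.* ℚ.toℚᵘ (fromℤ j)      ≃⟨ ℚP.toℚᵘ-homo-* (fromℤ i) (fromℤ j) ⟨
    ℚ.toℚᵘ (fromℤ i * fromℤ j)                  ∎)
    where open ℚᵘP.≤-Reasoning

  fromℤ-neg : ∀ i → fromℤ (ℤ.- i) ≡ - fromℤ i
  fromℤ-neg i = ℚP.toℚᵘ-injective (begin-equality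
    ℚ.toℚᵘ (fromℤ (ℤ.- i))                      ≃⟨ fromℤ≃ (ℤ.- i) ⟩
    ℚᵘ.- mkℚᵘ i 0                               ≃⟨ ℚᵘP.-‿cong (fromℤ≃ i) ⟨
    ℚᵘ.- ℚ.toℚᵘ (fromℤ i)                       ≃⟨ ℚP.toℚᵘ-homo‿- (fromℤ i) ⟨
    ℚ.toℚᵘ (- fromℤ i)                          ∎)
    where open ℚᵘP.≤-Reasoning

  fromℤ-injective : ∀ {i j} → fromℤ i ≡ fromℤ j → i ≡ j
  fromℤ-injective {i} {j} eq with ℚᵘP.≃-trans (ℚᵘP.≃-sym (fromℤ≃ i)) (ℚᵘP.≃-trans (ℚP.toℚᵘ-cong eq) (fromℤ≃ j))
  ... | *≡* i*1≡j*1 = trans (sym (ℤP.*-identityʳ i)) (trans i*1≡j*1 (ℤP.*-identityʳ j))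

  fromℤ-minus : ∀ i j → fromℤ (i ℤ.- j) ≡ fromℤ i + - fromℤ j
  fromℤ-minus i j = trans (fromℤ-+ i (ℤ.- j)) (cong (fromℤ i +_) (fromℤ-neg j))

  *-cancelˡ-≡ : ∀ p q r .{{_ : ℚ.NonZero p}} → p * q ≡ p * r → q ≡ r
  *-cancelˡ-≡ p q r pq≡pr = begin
    q                ≡⟨ ℚP.*-identityˡ q ⟨
    1ℚ * q           ≡⟨ cong (_* q) (ℚP.*-inverseˡ p) ⟨
    1/ p * p * q     ≡⟨ ℚP.*-assoc (1/ p) p q ⟩
    1/ p * (p * q)   ≡⟨ cong (1/ p *_) pq≡pr ⟩
    1/ p * (p * r)   ≡⟨ ℚP.*-assoc (1/ p) p r ⟨
    1/ p * p * r     ≡⟨ cong (_* r) (ℚP.*-inverseˡ p) ⟩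
    1ℚ * r           ≡⟨ ℚP.*-identityˡ r ⟩
    r                ∎
    where open ≡-Reasoning

  ℚ-ring : AlmostCommutativeRing 0ℓ 0ℓ
  ℚ-ring = fromCommutativeRing ℚP.+-*-commutativeRing (λ x → dec⇒maybe (0ℚ ℚP.≟ x))

open Rationals

module LinearAlgebra where

  open import Data.Rational using (_+_; _*_; -_)

  open SemiringSum (CommutativeRing.semiring ℚP.+-*-commutativeRing)
    using (sum; sum-cong-≗; sum-replicate-zero; ∑-distrib-+; *-distribˡ-sum; *-distribʳ-sum)

  Dependent : ∀ {k n} → (Fin k → Fin n → ℚ) → Set
  Dependent {k} v = ∃ λ (c : Fin k → ℚ) → (∃ λ q → c q ≢ 0ℚ) × (∀ i → sum (λ q → c q * v q i) ≡ 0ℚ)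

  Independent : ∀ {k n} → (Fin k → Fin n → ℚ) → Set
  Independent {k} v = ∀ (c : Fin k → ℚ) → (∀ i → sum (λ q → c q * v q i) ≡ 0ℚ) → ∀ q → c q ≡ 0ℚ

  δ₀ : ∀ {k} → Fin (suc k) → ℚ
  δ₀ zero    = 1ℚ
  δ₀ (suc _) = 0ℚ

  zero-first-dependent : ∀ {k n} (v : Fin (suc k) → Fin n → ℚ) → (∀ i → v zero i ≡ 0ℚ) → Dependent v
  zero-first-dependent {k} v v₀≡0 = δ₀ , (zero , λ ()) , λ i → begin
    1ℚ * v zero i + sum (λ q → 0ℚ * v (suc q) i)
      ≡⟨ cong₂ _+_ (trans (ℚP.*-identityˡ _) (v₀≡0 i)) (sum-cong-≗ λ q → ℚP.*-zeroˡ (v (suc q) i)) ⟩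
    0ℚ + sum {k} (λ _ → 0ℚ)                       ≡⟨ cong (0ℚ +_) (sum-replicate-zero k) ⟩
    0ℚ                                            ∎
    where open ≡-Reasoning

  -- One step of Gaussian elimination: adding multiples of the first vector clears column j.
  module Elimination {k n} (v : Fin (suc k) → Fin (suc n) → ℚ) (j : Fin (suc n)) (v₀ⱼ≢0 : v zero j ≢ 0ℚ) where

    instance
      v₀ⱼ-nonZero : ℚ.NonZero (v zero j)
      v₀ⱼ-nonZero = ℚ.≢-nonZero v₀ⱼ≢0

    μ : Fin k → ℚ
    μ q = - (v (suc q) j * 1/ v zero j)

    reduced : Fin k → Fin n → ℚ
    reduced q i = v (suc q) (punchIn j i) + μ q * v zero (punchIn j i)

    μ-clears-pivot : ∀ q → v (suc q) j + μ q * v zero j ≡ 0ℚ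
    μ-clears-pivot q = begin
      v (suc q) j + - (v (suc q) j * 1/ v zero j) * v zero j    ≡⟨ cong (v (suc q) j +_) (ℚP.neg-distribˡ-* (v (suc q) j * 1/ v zero j) (v zero j)) ⟨
      v (suc q) j + - (v (suc q) j * 1/ v zero j * v zero j)    ≡⟨ cong (λ t → v (suc q) j + - t) (ℚP.*-assoc (v (suc q) j) (1/ v zero j) (v zero j)) ⟩
      v (suc q) j + - (v (suc q) j * (1/ v zero j * v zero j))  ≡⟨ cong (λ t → v (suc q) j + - (v (suc q) j * t)) (ℚP.*-inverseˡ (v zero j)) ⟩
      v (suc q) j + - (v (suc q) j * 1ℚ)                        ≡⟨ cong (λ t → v (suc q) j + - t) (ℚP.*-identityʳ (v (suc q) j)) ⟩
      v (suc q) j + - v (suc q) j                               ≡⟨ ℚP.+-inverseʳ (v (suc q) j) ⟩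
      0ℚ                                                        ∎
      where open ≡-Reasoning

    lift : Dependent reduced → Dependent v
    lift (c , (q , c≢0) , c-rel) = c′ , (suc q , c≢0) , c′-rel
      where
      open ≡-Reasoning
      c′ : Fin (suc k) → ℚ
      c′ zero    = sum λ q → c q * μ q
      c′ (suc q) = c q
      combined : Fin (suc n) → ℚ
      combined i = sum λ q → c q * (v (suc q) i + μ q * v zero i)
      combination : ∀ i → sum (λ q → c′ q * v q i) ≡ combined i
      combination i = begin
        sum (λ q → c q * μ q) * v zero i + sum (λ q → c q * v (suc q) i)
          ≡⟨ ℚP.+-comm (sum (λ q → c q * μ q) * v zero i) (sum (λ q → c q * v (suc q) i)) ⟩
        sum (λ q → c q * v (suc q) i) + sum (λ q → c q * μ q) * v zero i
          ≡⟨ cong (sum (λ q → c q * v (suc q) i) +_) (trans (*-distribʳ-sum (v zero i) (λ q → c q * μ q))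
                                                            (sum-cong-≗ λ q → ℚP.*-assoc (c q) (μ q) (v zero i))) ⟩
        sum (λ q → c q * v (suc q) i) + sum (λ q → c q * (μ q * v zero i))
          ≡⟨ ∑-distrib-+ (λ q → c q * v (suc q) i) (λ q → c q * (μ q * v zero i)) ⟨
        sum (λ q → c q * v (suc q) i + c q * (μ q * v zero i))
          ≡⟨ sum-cong-≗ (λ q → ℚP.*-distribˡ-+ (c q) _ _) ⟨
        combined i ∎
      c′-rel : ∀ i → sum (λ q → c′ q * v q i) ≡ 0ℚ
      c′-rel i with i Fin.≟ j
      ... | yes refl = begin
        sum (λ q → c′ q * v q i)   ≡⟨ combination i ⟩
        combined i                 ≡⟨ sum-cong-≗ (λ q → trans (cong (c q *_) (μ-clears-pivot q)) (ℚP.*-zeroʳ (c q))) ⟩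
        sum {k} (λ _ → 0ℚ)         ≡⟨ sum-replicate-zero k ⟩
        0ℚ                         ∎
      ... | no i≢j = begin
        sum (λ q → c′ q * v q i)         ≡⟨ combination i ⟩
        combined i                       ≡⟨ cong combined (FinP.punchIn-punchOut j≢i) ⟨
        combined (punchIn j (punchOut j≢i)) ≡⟨ c-rel (punchOut j≢i) ⟩
        0ℚ                               ∎
        where
        j≢i : j ≢ i
        j≢i j≡i = i≢j (sym j≡i)

  dependent : ∀ {k n} → n ℕ.< k → (v : Fin k → Fin n → ℚ) → Dependent v
  dependent {suc k} {zero}  _          v = δ₀ , (zero , λ ()) , λ ()
  dependent {suc k} {suc n} (s≤s n<k) v with FinP.any? (λ i → ¬? (v zero i ℚP.≟ 0ℚ))
  ... | yes (j , v₀ⱼ≢0) = lift (dependent n<k reduced)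
    where open Elimination v j v₀ⱼ≢0
  ... | no ¬nonzero = zero-first-dependent v λ i → decidable-stable (v zero i ℚP.≟ 0ℚ) (λ v₀ᵢ≢0 → ¬nonzero (i , v₀ᵢ≢0))

  head-coefficient≢0 : ∀ {n} (v : Fin n → Fin n → ℚ) → Independent v →
                       ∀ w → ((c , _ , _) : Dependent (w ∷ v)) → c zero ≢ 0ℚ
  head-coefficient≢0 v independent w (c , (q , c≢0) , c-rel) c₀≡0 = c≢0 (all-zero q)
    where
    open ≡-Reasoning
    tail-rel : ∀ i → sum (λ q → c (suc q) * v q i) ≡ 0ℚ
    tail-rel i = begin
      sum (λ q → c (suc q) * v q i)                 ≡⟨ ℚP.+-identityˡ _ ⟨
      0ℚ + sum (λ q → c (suc q) * v q i)            ≡⟨ cong (_+ sum (λ q → c (suc q) * v q i)) c₀wᵢ≡0 ⟨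
      c zero * w i + sum (λ q → c (suc q) * v q i)  ≡⟨ c-rel i ⟩
      0ℚ                                            ∎
      where
      c₀wᵢ≡0 : c zero * w i ≡ 0ℚ
      c₀wᵢ≡0 = trans (cong (_* w i) c₀≡0) (ℚP.*-zeroˡ (w i))
    all-zero : ∀ q → c q ≡ 0ℚ
    all-zero zero    = c₀≡0
    all-zero (suc q) = independent (λ q → c (suc q)) tail-rel q

  solve-for-head : ∀ {n} (v : Fin n → Fin n → ℚ) w (c : Fin (suc n) → ℚ) → c zero ≢ 0ℚ →
                   (∀ i → sum (λ q → c q * (w ∷ v) q i) ≡ 0ℚ) →
                   ∃ λ c′ → ∀ i → w i ≡ sum (λ q → c′ q * v q i)
  solve-for-head v w c c₀≢0 c-rel = (λ q → - (1/ c zero) * c (suc q)) , λ i → begin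
    w i                                             ≡⟨ ℚP.*-identityˡ (w i) ⟨
    1ℚ * w i                                        ≡⟨ cong (_* w i) (ℚP.*-inverseˡ (c zero)) ⟨
    1/ c zero * c zero * w i                        ≡⟨ ℚP.*-assoc (1/ c zero) (c zero) (w i) ⟩
    1/ c zero * (c zero * w i)                      ≡⟨ cong (1/ c zero *_) (inverseˡ-unique (c zero * w i) (S i) (c-rel i)) ⟩
    1/ c zero * - S i                               ≡⟨ ℚP.neg-distribʳ-* (1/ c zero) (S i) ⟨
    - (1/ c zero * S i)                             ≡⟨ ℚP.neg-distribˡ-* (1/ c zero) (S i) ⟩
    - (1/ c zero) * S i                             ≡⟨ *-distribˡ-sum (- (1/ c zero)) (λ q → c (suc q) * v q i) ⟩
    sum (λ q → - (1/ c zero) * (c (suc q) * v q i)) ≡⟨ sum-cong-≗ (λ q → ℚP.*-assoc (- (1/ c zero)) (c (suc q)) (v q i)) ⟨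
    sum (λ q → - (1/ c zero) * c (suc q) * v q i)   ∎
    where
    open ≡-Reasoning
    open GroupProperties ℚP.+-0-group using (inverseˡ-unique)
    instance
      c₀-nonZero : ℚ.NonZero (c zero)
      c₀-nonZero = ℚ.≢-nonZero c₀≢0
    S : Fin _ → ℚ
    S i = sum λ q → c (suc q) * v q i

  independent⇒spanning : ∀ {n} (v : Fin n → Fin n → ℚ) → Independent v →
                         ∀ w → ∃ λ c → ∀ i → w i ≡ sum (λ q → c q * v q i)
  independent⇒spanning {n} v independent w =
    let dependence@(c , _ , c-rel) = dependent (ℕP.n<1+n n) (w ∷ v) in
    solve-for-head v w c (head-coefficient≢0 v independent w dependence) c-rel

open LinearAlgebra

module IntegerArithmetic where

  open import Data.Integer using (+_; _+_; _*_; _-_; ∣_∣)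

  even-or-odd : ∀ z → z ≡ z ℤ./ + 2 * + 2 ⊎ z ≡ + 1 + z ℤ./ + 2 * + 2
  even-or-odd z with z ℤ.% + 2 | a≡a%n+[a/n]*n z (+ 2) | n%d<d z (+ 2)
  ... | 0           | z≡[z/2]*2   | _                = inj₁ (trans z≡[z/2]*2 (ℤP.+-identityˡ _))
  ... | 1           | z≡1+[z/2]*2 | _                = inj₂ z≡1+[z/2]*2
  ... | suc (suc _) | _           | s≤s (s≤s ())

  odd≢even : ∀ a b → + 1 + a * + 2 ≢ b * + 2
  odd≢even a b odd≡even = 1≢2n ∣ b - a ∣ (begin
    1                     ≡⟨ cong ∣_∣ (trans (1≡odd-2a a) (cong (_- a * + 2) odd≡even)) ⟩
    ∣ b * + 2 - a * + 2 ∣ ≡⟨ cong ∣_∣ (*-distribʳ-minus b a) ⟩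
    ∣ (b - a) * + 2 ∣     ≡⟨ ℤP.abs-* (b - a) (+ 2) ⟩
    ∣ b - a ∣ ℕ.* 2       ∎)
    where
    open ≡-Reasoning
    1≡odd-2a : ∀ a → + 1 ≡ + 1 + a * + 2 - a * + 2
    1≡odd-2a = solve-∀
    *-distribʳ-minus : ∀ b a → b * + 2 - a * + 2 ≡ (b - a) * + 2
    *-distribʳ-minus = solve-∀
    1≢2n : ∀ n → 1 ≢ n ℕ.* 2
    1≢2n zero    ()
    1≢2n (suc n) ()

  positive-product≡1 : ∀ {a b} → 0ℤ ℤ.< a → 0ℤ ℤ.< b → a * b ≡ 1ℤ → a ≡ 1ℤ
  positive-product≡1 {+ suc m} {+ suc n} _ _ ab≡1 = cong +_ (ℕP.m*n≡1⇒m≡1 (suc m) (suc n) (cong ∣_∣ ab≡1))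
  positive-product≡1 {+ suc _} {+ zero} _ (ℤ.+<+ ()) _

open IntegerArithmetic

module ℤᵛ = StructureConstants ℤP.+-*-isCommutativeRing
module ℚᵛ = StructureConstants ℚP.+-*-isCommutativeRing

fromℤ-∑₄ : ∀ f → fromℤ (ℤᵛ.∑₄ f) ≡ ℚᵛ.∑₄ (λ i → fromℤ (f i))
fromℤ-∑₄ f = begin
  fromℤ (f f0 ℤ.+ f f1 ℤ.+ f f2 ℤ.+ f f3)                     ≡⟨ fromℤ-+ (f f0 ℤ.+ f f1 ℤ.+ f f2) (f f3) ⟩
  fromℤ (f f0 ℤ.+ f f1 ℤ.+ f f2) ℚ.+ fromℤ (f f3)             ≡⟨ cong (ℚ._+ fromℤ (f f3)) (fromℤ-+ (f f0 ℤ.+ f f1) (f f2)) ⟩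
  fromℤ (f f0 ℤ.+ f f1) ℚ.+ fromℤ (f f2) ℚ.+ fromℤ (f f3)     ≡⟨ cong (λ s → s ℚ.+ fromℤ (f f2) ℚ.+ fromℤ (f f3)) (fromℤ-+ (f f0) (f f1)) ⟩
  ℚᵛ.∑₄ (λ i → fromℤ (f i))                                   ∎
  where open ≡-Reasoning

fromℤ-δ : ∀ {n} (i j : Fin n) → fromℤ (ℤᵛ.δ i j) ≡ ℚᵛ.δ i j
fromℤ-δ zero    zero    = refl
fromℤ-δ zero    (suc _) = refl
fromℤ-δ (suc _) zero    = refl
fromℤ-δ (suc i) (suc j) = fromℤ-δ i j

oneℤ≐e₀ : oneℤ ≐ ℤᵛ.δ f0
oneℤ≐e₀ zero    = refl
oneℤ≐e₀ (suc _) = refl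

oneℚ≐e₀ : oneℚ ≐ ℚᵛ.δ f0
oneℚ≐e₀ zero    = refl
oneℚ≐e₀ (suc _) = refl

record QuaternionGenerators (C : Fin 4 → Fin 4 → Fin 4 → ℚ) : Set where
  open ℚᵛ using (_⊕_; _•_; ⊝_)
  open ℚᵛ.Algebra C using (_∙_; e)
  field
    i j   : V4 ℚ
    a b   : ℚ
    a≢0   : a ≢ 0ℚ
    b≢0   : b ≢ 0ℚ
    i∙i   : (i ∙ i) ≐ (a • e f0)
    j∙j   : (j ∙ j) ≐ (b • e f0)
    j∙i   : (j ∙ i) ≐ (⊝ (i ∙ j))
    independent : ∀ r s t u → (r • e f0 ⊕ (s • i ⊕ (t • j ⊕ u • (i ∙ j)))) ≐ (λ _ → 0ℚ) →
                  r ≡ 0ℚ × s ≡ 0ℚ × t ≡ 0ℚ × u ≡ 0ℚ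

module QuaternionBasis
  (C : Fin 4 → Fin 4 → Fin 4 → ℚ)
  (assoc : ℚᵛ.Algebra.Associative C)
  (identityˡ : ℚᵛ.Algebra.Identityˡ C)
  (identityʳ : ℚᵛ.Algebra.Identityʳ C)
  (generators : QuaternionGenerators C)
  where

  open ℚᵛ.Algebra C

  open import Data.Rational using (_+_; _*_; -_)

  open QuaternionGenerators generators
  open ℚᵛ using (_⊕_; _•_; ⊝_; ∑₄; ∑₄-cong; ∑ᵛ)
  open ≡-Reasoning

  1ᵛ k : V4 ℚ
  1ᵛ = e f0
  k = i ∙ j

  i∙k : (i ∙ k) ≐ (a • j)
  i∙k m = begin
    (i ∙ (i ∙ j)) m      ≡⟨ assoc i i j m ⟨
    ((i ∙ i) ∙ j) m      ≡⟨ ∙-congˡ j i∙i m ⟩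
    ((a • 1ᵛ) ∙ j) m     ≡⟨ ∙-scaleˡ a 1ᵛ j m ⟩
    a * (1ᵛ ∙ j) m       ≡⟨ cong (a *_) (identityˡ j m) ⟩
    a * j m              ∎

  k∙i : (k ∙ i) ≐ (⊝ (a • j))
  k∙i m = begin
    ((i ∙ j) ∙ i) m      ≡⟨ assoc i j i m ⟩
    (i ∙ (j ∙ i)) m      ≡⟨ ∙-congʳ i j∙i m ⟩
    (i ∙ (⊝ k)) m        ≡⟨ ∙-negʳ i k m ⟩
    - (i ∙ k) m          ≡⟨ cong -_ (i∙k m) ⟩
    - (a * j m)          ∎

  k∙j : (k ∙ j) ≐ (b • i)
  k∙j m = begin
    ((i ∙ j) ∙ j) m      ≡⟨ assoc i j j m ⟩
    (i ∙ (j ∙ j)) m      ≡⟨ ∙-congʳ i j∙j m ⟩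
    (i ∙ (b • 1ᵛ)) m     ≡⟨ ∙-scaleʳ b i 1ᵛ m ⟩
    b * (i ∙ 1ᵛ) m       ≡⟨ cong (b *_) (identityʳ i m) ⟩
    b * i m              ∎

  j∙k : (j ∙ k) ≐ (⊝ (b • i))
  j∙k m = begin
    (j ∙ (i ∙ j)) m      ≡⟨ assoc j i j m ⟨
    ((j ∙ i) ∙ j) m      ≡⟨ ∙-congˡ j j∙i m ⟩
    ((⊝ k) ∙ j) m        ≡⟨ ∙-negˡ k j m ⟩
    - (k ∙ j) m          ≡⟨ cong -_ (k∙j m) ⟩
    - (b * i m)          ∎

  k∙k : (k ∙ k) ≐ (⊝ (a • (b • 1ᵛ)))
  k∙k m = begin
    (k ∙ (i ∙ j)) m      ≡⟨ assoc k i j m ⟨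
    ((k ∙ i) ∙ j) m      ≡⟨ ∙-congˡ j k∙i m ⟩
    ((⊝ (a • j)) ∙ j) m  ≡⟨ ∙-negˡ (a • j) j m ⟩
    - ((a • j) ∙ j) m    ≡⟨ cong -_ (∙-scaleˡ a j j m) ⟩
    - (a * (j ∙ j) m)    ≡⟨ cong (λ t → - (a * t)) (j∙j m) ⟩
    - (a * (b * 1ᵛ m))   ∎

  basis : Fin 4 → V4 ℚ
  basis 0F = 1ᵛ
  basis 1F = i
  basis 2F = j
  basis 3F = k

  lc : (Fin 4 → ℚ) → V4 ℚ
  lc q = ∑ᵛ q basis

  product-table : Fin 4 → Fin 4 → V4 ℚ
  product-table 0F β  = basis β
  product-table 1F 0F = i
  product-table 1F 1F = a • 1ᵛ
  product-table 1F 2F = k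
  product-table 1F 3F = a • j
  product-table 2F 0F = j
  product-table 2F 1F = ⊝ k
  product-table 2F 2F = b • 1ᵛ
  product-table 2F 3F = ⊝ (b • i)
  product-table 3F 0F = k
  product-table 3F 1F = ⊝ (a • j)
  product-table 3F 2F = b • i
  product-table 3F 3F = ⊝ (a • (b • 1ᵛ))

  basis-∙ : ∀ α β → (basis α ∙ basis β) ≐ product-table α β
  basis-∙ 0F β  = identityˡ (basis β)
  basis-∙ 1F 0F = identityʳ i
  basis-∙ 1F 1F = i∙i
  basis-∙ 1F 2F = λ _ → refl
  basis-∙ 1F 3F = i∙k
  basis-∙ 2F 0F = identityʳ j
  basis-∙ 2F 1F = j∙i
  basis-∙ 2F 2F = j∙j
  basis-∙ 2F 3F = j∙k
  basis-∙ 3F 0F = identityʳ k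
  basis-∙ 3F 1F = k∙i
  basis-∙ 3F 2F = k∙j
  basis-∙ 3F 3F = k∙k

  infixl 7 _⋆_

  _⋆_ : (Fin 4 → ℚ) → (Fin 4 → ℚ) → Fin 4 → ℚ
  (q ⋆ r) 0F = q 0F * r 0F + a * (q 1F * r 1F) + b * (q 2F * r 2F) + - (a * b * (q 3F * r 3F))
  (q ⋆ r) 1F = q 0F * r 1F + q 1F * r 0F + - (b * (q 2F * r 3F)) + b * (q 3F * r 2F)
  (q ⋆ r) 2F = q 0F * r 2F + q 2F * r 0F + a * (q 1F * r 3F) + - (a * (q 3F * r 1F))
  (q ⋆ r) 3F = q 0F * r 3F + q 3F * r 0F + q 1F * r 2F + - (q 2F * r 1F)

  norm : (Fin 4 → ℚ) → ℚ
  norm q = q 0F * q 0F + - (a * (q 1F * q 1F)) + - (b * (q 2F * q 2F)) + a * b * (q 3F * q 3F)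

  lc-∙ : ∀ q r → (lc q ∙ lc r) ≐ lc (q ⋆ r)
  lc-∙ q r m = begin
    (lc q ∙ lc r) m
      ≡⟨ ∙-∑ᵛˡ q basis (lc r) m ⟩
    ∑₄ (λ α → q α * (basis α ∙ lc r) m)
      ≡⟨ ∑₄-cong (λ α → cong (q α *_) (∙-∑ᵛʳ r basis (basis α) m)) ⟩
    ∑₄ (λ α → q α * ∑₄ λ β → r β * (basis α ∙ basis β) m)
      ≡⟨ ∑₄-cong (λ α → cong (q α *_) (∑₄-cong λ β → cong (r β *_) (basis-∙ α β m))) ⟩
    ∑₄ (λ α → q α * ∑₄ λ β → r β * product-table α β m)
      ≡⟨ expand (q 0F) (q 1F) (q 2F) (q 3F) (r 0F) (r 1F) (r 2F) (r 3F) a b (1ᵛ m) (i m) (j m) (k m) ⟩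
    lc (q ⋆ r) m ∎
    where
    expand : ∀ q0 q1 q2 q3 r0 r1 r2 r3 a b O I J K →
      q0 * (r0 * O + r1 * I + r2 * J + r3 * K)
      + q1 * (r0 * I + r1 * (a * O) + r2 * K + r3 * (a * J))
      + q2 * (r0 * J + r1 * (- K) + r2 * (b * O) + r3 * (- (b * I)))
      + q3 * (r0 * K + r1 * (- (a * J)) + r2 * (b * I) + r3 * (- (a * (b * O))))
      ≡ (q0 * r0 + a * (q1 * r1) + b * (q2 * r2) + - (a * b * (q3 * r3))) * O
      + (q0 * r1 + q1 * r0 + - (b * (q2 * r3)) + b * (q3 * r2)) * I
      + (q0 * r2 + q2 * r0 + a * (q1 * r3) + - (a * (q3 * r1))) * J
      + (q0 * r3 + q3 * r0 + q1 * r2 + - (q2 * r1)) * K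
    expand = RingSolver.solve-∀ ℚ-ring

  norm-⋆ : ∀ q r → norm (q ⋆ r) ≡ norm q * norm r
  norm-⋆ q r = multiplicative a b (q 0F) (q 1F) (q 2F) (q 3F) (r 0F) (r 1F) (r 2F) (r 3F)
    where
    multiplicative : ∀ a b q0 q1 q2 q3 r0 r1 r2 r3 →
      let N = λ q0 q1 q2 q3 → q0 * q0 + - (a * (q1 * q1)) + - (b * (q2 * q2)) + a * b * (q3 * q3) in
      N (q0 * r0 + a * (q1 * r1) + b * (q2 * r2) + - (a * b * (q3 * r3)))
        (q0 * r1 + q1 * r0 + - (b * (q2 * r3)) + b * (q3 * r2))
        (q0 * r2 + q2 * r0 + a * (q1 * r3) + - (a * (q3 * r1)))
        (q0 * r3 + q3 * r0 + q1 * r2 + - (q2 * r1))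
      ≡ N q0 q1 q2 q3 * N r0 r1 r2 r3
    multiplicative = RingSolver.solve-∀ ℚ-ring

  lc-square : ∀ q m → (lc q ∙ lc q) m ≡ (q 0F + q 0F) * lc q m + - (norm q * 1ᵛ m)
  lc-square q m = trans (lc-∙ q q m) (square (q 0F) (q 1F) (q 2F) (q 3F) a b (1ᵛ m) (i m) (j m) (k m))
    where
    square : ∀ q0 q1 q2 q3 a b O I J K →
      (q0 * q0 + a * (q1 * q1) + b * (q2 * q2) + - (a * b * (q3 * q3))) * O
      + (q0 * q1 + q1 * q0 + - (b * (q2 * q3)) + b * (q3 * q2)) * I
      + (q0 * q2 + q2 * q0 + a * (q1 * q3) + - (a * (q3 * q1))) * J
      + (q0 * q3 + q3 * q0 + q1 * q2 + - (q2 * q1)) * K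
      ≡ (q0 + q0) * (q0 * O + q1 * I + q2 * J + q3 * K)
        + - ((q0 * q0 + - (a * (q1 * q1)) + - (b * (q2 * q2)) + a * b * (q3 * q3)) * O)
    square = RingSolver.solve-∀ ℚ-ring

  tr-anticommuting : ∀ x y z s → s ≢ 0ℚ → (x ∙ y) ≐ (s • z) → (y ∙ x) ≐ (⊝ (s • z)) → tr z ≡ 0ℚ
  tr-anticommuting x y z s s≢0 x∙y y∙x =
    *-cancelˡ-≡ s (tr z) 0ℚ {{ℚ.≢-nonZero s≢0}} (trans (self-negating (begin
    s * tr z         ≡⟨ tr-• s z ⟨
    tr (s • z)       ≡⟨ tr-cong x∙y ⟨
    tr (x ∙ y)       ≡⟨ tr-comm assoc x y ⟩
    tr (y ∙ x)       ≡⟨ tr-cong y∙x ⟩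
    tr (⊝ (s • z))   ≡⟨ tr-⊝ (s • z) ⟩
    - tr (s • z)     ≡⟨ cong -_ (tr-• s z) ⟩
    - (s * tr z)     ∎)) (sym (ℚP.*-zeroʳ s)))
    where
    self-negating : ∀ {t} → t ≡ - t → t ≡ 0ℚ
    self-negating {t} t≡-t = *-cancelˡ-≡ (1ℚ + 1ℚ) t 0ℚ {{ℚ.≢-nonZero {1ℚ + 1ℚ} λ ()}} (begin
      (1ℚ + 1ℚ) * t   ≡⟨ ℚP.*-distribʳ-+ t 1ℚ 1ℚ ⟩
      1ℚ * t + 1ℚ * t ≡⟨ cong₂ _+_ (ℚP.*-identityˡ t) (trans (ℚP.*-identityˡ t) t≡-t) ⟩
      t + - t         ≡⟨ ℚP.+-inverseʳ t ⟩
      0ℚ              ≡⟨ ℚP.*-zeroʳ (1ℚ + 1ℚ) ⟨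
      (1ℚ + 1ℚ) * 0ℚ  ∎)

  tr-basis : ∀ α → tr (basis α) ≡ ℚᵛ.δ f0 α * (1ℚ + 1ℚ + 1ℚ + 1ℚ)
  tr-basis 0F = trans (tr-e₀ identityˡ) (sym (ℚP.*-identityˡ (1ℚ + 1ℚ + 1ℚ + 1ℚ)))
  tr-basis 1F = trans (tr-anticommuting k j i b b≢0 k∙j j∙k) (sym (ℚP.*-zeroˡ (1ℚ + 1ℚ + 1ℚ + 1ℚ)))
  tr-basis 2F = trans (tr-anticommuting i k j a a≢0 i∙k k∙i) (sym (ℚP.*-zeroˡ (1ℚ + 1ℚ + 1ℚ + 1ℚ)))
  tr-basis 3F = trans (tr-anticommuting i j k 1ℚ (λ ()) i∙j j∙i′) (sym (ℚP.*-zeroˡ (1ℚ + 1ℚ + 1ℚ + 1ℚ)))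
    where
    i∙j : (i ∙ j) ≐ (1ℚ • k)
    i∙j m = sym (ℚP.*-identityˡ (k m))
    j∙i′ : (j ∙ i) ≐ (⊝ (1ℚ • k))
    j∙i′ m = trans (j∙i m) (cong -_ (i∙j m))

  tr-lc : ∀ q → tr (lc q) ≡ (q 0F + q 0F) + (q 0F + q 0F)
  tr-lc q = begin
    tr (lc q)                                                  ≡⟨ tr-∑ᵛ q basis ⟩
    ∑₄ (λ α → q α * tr (basis α))                              ≡⟨ ∑₄-cong (λ α → cong (q α *_) (tr-basis α)) ⟩
    ∑₄ (λ α → q α * (ℚᵛ.δ f0 α * (1ℚ + 1ℚ + 1ℚ + 1ℚ)))         ≡⟨ collect (q 0F) (q 1F) (q 2F) (q 3F) ⟩
    (q 0F + q 0F) + (q 0F + q 0F)                              ∎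
    where
    collect : ∀ q0 q1 q2 q3 → let four = 1ℚ + 1ℚ + 1ℚ + 1ℚ in
      q0 * (1ℚ * four) + q1 * (0ℚ * four) + q2 * (0ℚ * four) + q3 * (0ℚ * four) ≡ (q0 + q0) + (q0 + q0)
    collect = RingSolver.solve-∀ ℚ-ring

  basis-independent : Independent basis
  basis-independent q q-rel = all-zero
    where
    rel : (q 0F • 1ᵛ ⊕ (q 1F • i ⊕ (q 2F • j ⊕ q 3F • k))) ≐ (λ _ → 0ℚ)
    rel m = trans (cong (λ t → q 0F * 1ᵛ m + (q 1F * i m + (q 2F * j m + t))) (sym (ℚP.+-identityʳ (q 3F * k m))))
                  (q-rel m)
    zeros : q 0F ≡ 0ℚ × q 1F ≡ 0ℚ × q 2F ≡ 0ℚ × q 3F ≡ 0ℚ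
    zeros = independent (q 0F) (q 1F) (q 2F) (q 3F) rel
    all-zero : ∀ α → q α ≡ 0ℚ
    all-zero 0F = proj₁ zeros
    all-zero 1F = proj₁ (proj₂ zeros)
    all-zero 2F = proj₁ (proj₂ (proj₂ zeros))
    all-zero 3F = proj₂ (proj₂ (proj₂ zeros))

  coordinates : ∀ w → ∃ λ q → w ≐ lc q
  coordinates w = Product.map₂ (λ {q} w≐∑ m → trans (w≐∑ m) (sym (ℚᵛ.∑₄≡sum λ α → q α * basis α m)))
                               (independent⇒spanning basis basis-independent w)

module QuaternionOrder (c : StructConst) (isQuaternionOrder : IsQuaternionOrder c) where

  open import Data.Integer using (+_)
  open import Data.Rational using (_+_; _*_; -_)

  open IsQuaternionOrder isQuaternionOrder
  open ≡-Reasoning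

  module ℤᴬ = ℤᵛ.Algebra c
  cℚ : Fin 4 → Fin 4 → Fin 4 → ℚ
  cℚ i j k = fromℤ (c i j k)

  module ℚᴬ = ℚᵛ.Algebra cℚ

  embed-∙ : ∀ x y → embed (mulℤ c x y) ≐ mulℚ c (embed x) (embed y)
  embed-∙ x y k = trans (fromℤ-∑₄ λ i → ℤᵛ.∑₄ λ j → x i ℤ.* y j ℤ.* c i j k) (ℚᵛ.∑₄-cong λ i →
    trans (fromℤ-∑₄ λ j → x i ℤ.* y j ℤ.* c i j k) (ℚᵛ.∑₄-cong λ j →
    trans (fromℤ-* (x i ℤ.* y j) (c i j k)) (cong (ℚ._* fromℤ (c i j k)) (fromℤ-* (x i) (y j)))))

  embed-tr : ∀ x → fromℤ (traceL c x) ≡ ℚᴬ.tr (embed x)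
  embed-tr x = trans (fromℤ-∑₄ λ k → mulℤ c x (ℤᴬ.e k) k) (ℚᵛ.∑₄-cong λ k →
    trans (embed-∙ x (ℤᴬ.e k) k) (ℚᴬ.∙-congʳ (embed x) (fromℤ-δ k) k))

  fromℤ-assoc-constants : ℤᴬ.AssociativeConstants → ℚᴬ.AssociativeConstants
  fromℤ-assoc-constants assoc a b d k = begin
    ℚᵛ.∑₄ (λ l → fromℤ (c a b l) ℚ.* fromℤ (c l d k))   ≡⟨ fromℤ-∑∗ (λ l → c a b l) (λ l → c l d k) ⟨
    fromℤ (ℤᵛ.∑₄ λ l → c a b l ℤ.* c l d k)            ≡⟨ cong fromℤ (assoc a b d k) ⟩
    fromℤ (ℤᵛ.∑₄ λ l → c b d l ℤ.* c a l k)            ≡⟨ fromℤ-∑∗ (λ l → c b d l) (λ l → c a l k) ⟩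
    ℚᵛ.∑₄ (λ l → fromℤ (c b d l) ℚ.* fromℤ (c a l k))   ∎
    where
    fromℤ-∑∗ : ∀ f g → fromℤ (ℤᵛ.∑₄ λ l → f l ℤ.* g l) ≡ ℚᵛ.∑₄ λ l → fromℤ (f l) ℚ.* fromℤ (g l)
    fromℤ-∑∗ f g = trans (fromℤ-∑₄ λ l → f l ℤ.* g l) (ℚᵛ.∑₄-cong λ l → fromℤ-* (f l) (g l))

  ℚ-assoc : ℚᴬ.Associative
  ℚ-assoc = ℚᴬ.assoc-constants⇒assoc (fromℤ-assoc-constants (ℤᴬ.assoc⇒assoc-constants assoc))

  ℚ-identityˡ : ℚᴬ.Identityˡ
  ℚ-identityˡ = ℚᴬ.constants⇒identityˡ λ b k →
    trans (cong fromℤ (ℤᴬ.identityˡ⇒constants unitˡ b k)) (fromℤ-δ b k)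

  ℚ-identityʳ : ℚᴬ.Identityʳ
  ℚ-identityʳ = ℚᴬ.constants⇒identityʳ λ a k →
    trans (cong fromℤ (ℤᴬ.identityʳ⇒constants unitʳ a k)) (fromℤ-δ a k)

  generators : QuaternionGenerators cℚ
  generators with quat
  ... | i , j , a , b , a≢0 , b≢0 , i∙i , j∙j , j∙i , independent = record
    { i = i ; j = j ; a = a ; b = b ; a≢0 = a≢0 ; b≢0 = b≢0
    ; i∙i = λ m → trans (i∙i m) (cong (a *_) (oneℚ≐e₀ m))
    ; j∙j = λ m → trans (j∙j m) (cong (b *_) (oneℚ≐e₀ m))
    ; j∙i = λ m → trans (j∙i m) (trans (sym (ℚP.neg-distribˡ-* 1ℚ (mulℚ c i j m))) (cong -_ (ℚP.*-identityˡ (mulℚ c i j m))))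
    ; independent = λ r s t u rel → independent r s t u λ m →
        trans (cong (λ o → r * o + (s * i m + (t * j m + u * mulℚ c i j m))) (oneℚ≐e₀ m)) (rel m)
    }

  open QuaternionBasis cℚ ℚ-assoc ℚ-identityˡ ℚ-identityʳ generators

  fromℤ-oneℤ : ∀ m → fromℤ (oneℤ m) ≡ 1ᵛ m
  fromℤ-oneℤ m = trans (cong fromℤ (oneℤ≐e₀ m)) (fromℤ-δ f0 m)

  even-coordinates⇒even-trace : ∀ x → (∀ m → x (suc m) ≡ x (suc m) ℤ./ + 2 ℤ.* + 2) →
                                ∃ λ t → traceL c x ≡ t ℤ.* + 2
  even-coordinates⇒even-trace x even = x f0 ℤ.* + 2 ℤ.+ ℤᴬ.tr y , (begin
    ℤᴬ.tr x                                        ≡⟨ ℤᴬ.tr-cong decomposition ⟩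
    ℤᴬ.tr (x f0 ℤᵛ.• ℤᴬ.e f0 ℤᵛ.⊕ + 2 ℤᵛ.• y)      ≡⟨ ℤᴬ.tr-⊕ (x f0 ℤᵛ.• ℤᴬ.e f0) (+ 2 ℤᵛ.• y) ⟩
    ℤᴬ.tr (x f0 ℤᵛ.• ℤᴬ.e f0) ℤ.+ ℤᴬ.tr (+ 2 ℤᵛ.• y) ≡⟨ cong₂ ℤ._+_ (ℤᴬ.tr-• (x f0) (ℤᴬ.e f0)) (ℤᴬ.tr-• (+ 2) y) ⟩
    x f0 ℤ.* ℤᴬ.tr (ℤᴬ.e f0) ℤ.+ + 2 ℤ.* ℤᴬ.tr y   ≡⟨ cong (λ t → x f0 ℤ.* t ℤ.+ + 2 ℤ.* ℤᴬ.tr y) (ℤᴬ.tr-e₀ unitˡ) ⟩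
    x f0 ℤ.* + 4 ℤ.+ + 2 ℤ.* ℤᴬ.tr y               ≡⟨ regroup (x f0) (ℤᴬ.tr y) ⟩
    (x f0 ℤ.* + 2 ℤ.+ ℤᴬ.tr y) ℤ.* + 2             ∎)
    where
    y : V4 ℤ
    y zero    = 0ℤ
    y (suc m) = x (suc m) ℤ./ + 2
    decomposition : x ≐ (x f0 ℤᵛ.• ℤᴬ.e f0 ℤᵛ.⊕ + 2 ℤᵛ.• y)
    decomposition zero    = sym (trans (ℤP.+-identityʳ _) (ℤP.*-identityʳ (x f0)))
    decomposition (suc m) = trans (even m) (sym (begin
      x f0 ℤ.* 0ℤ ℤ.+ + 2 ℤ.* y (suc m)   ≡⟨ cong (ℤ._+ + 2 ℤ.* y (suc m)) (ℤP.*-zeroʳ (x f0)) ⟩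
      0ℤ ℤ.+ + 2 ℤ.* y (suc m)            ≡⟨ ℤP.+-identityˡ _ ⟩
      + 2 ℤ.* y (suc m)                   ≡⟨ ℤP.*-comm (+ 2) (y (suc m)) ⟩
      y (suc m) ℤ.* + 2                   ∎))
    regroup : ∀ a t → a ℤ.* + 4 ℤ.+ + 2 ℤ.* t ≡ (a ℤ.* + 2 ℤ.+ t) ℤ.* + 2
    regroup = solve-∀

  module Integral (x : V4 ℤ) (q : Fin 4 → ℚ) (x≐q : embed x ≐ lc q) where

    fromℤ-traceL : fromℤ (traceL c x) ≡ (q 0F + q 0F) + (q 0F + q 0F)
    fromℤ-traceL = trans (embed-tr x) (trans (ℚᴬ.tr-cong x≐q) (tr-lc q))

    fromℤ-square : ∀ m → fromℤ (mulℤ c x x m) ≡ (q 0F + q 0F) * fromℤ (x m) + - (norm q * fromℤ (oneℤ m))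
    fromℤ-square m = begin
      fromℤ (mulℤ c x x m)                              ≡⟨ embed-∙ x x m ⟩
      mulℚ c (embed x) (embed x) m                      ≡⟨ ℚᴬ.∙-congˡ (embed x) x≐q m ⟩
      mulℚ c (lc q) (embed x) m                         ≡⟨ ℚᴬ.∙-congʳ (lc q) x≐q m ⟩
      mulℚ c (lc q) (lc q) m                            ≡⟨ lc-square q m ⟩
      (q 0F + q 0F) * lc q m + - (norm q * 1ᵛ m)        ≡⟨ cong₂ (λ s t → (q 0F + q 0F) * s + - (norm q * t)) (sym (x≐q m)) (sym (fromℤ-oneℤ m)) ⟩
      (q 0F + q 0F) * fromℤ (x m) + - (norm q * fromℤ (oneℤ m)) ∎

    twice-square : ∀ m → mulℤ c x x (suc m) ℤ.* + 2 ≡ traceL c x ℤ.* x (suc m)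
    twice-square m = fromℤ-injective (begin
      fromℤ (mulℤ c x x (suc m) ℤ.* + 2)                    ≡⟨ fromℤ-* (mulℤ c x x (suc m)) (+ 2) ⟩
      fromℤ (mulℤ c x x (suc m)) * (1ℚ + 1ℚ)                ≡⟨ cong (_* (1ℚ + 1ℚ)) (fromℤ-square (suc m)) ⟩
      ((q 0F + q 0F) * X + - (norm q * 0ℚ)) * (1ℚ + 1ℚ)     ≡⟨ regroup (q 0F) X (norm q) ⟩
      ((q 0F + q 0F) + (q 0F + q 0F)) * X                   ≡⟨ cong (_* X) fromℤ-traceL ⟨
      fromℤ (traceL c x) * X                                ≡⟨ fromℤ-* (traceL c x) (x (suc m)) ⟨
      fromℤ (traceL c x ℤ.* x (suc m))                      ∎)
      where
      X : ℚ
      X = fromℤ (x (suc m))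
      regroup : ∀ q0 X N → ((q0 + q0) * X + - (N * 0ℚ)) * (1ℚ + 1ℚ) ≡ ((q0 + q0) + (q0 + q0)) * X
      regroup = RingSolver.solve-∀ ℚ-ring

    -- trd is traceL / 2 with integer division, so this is what makes trd the reduced trace.
    -- If traceL x were odd, twice-square would force every non-scalar coordinate of x to be even,
    -- and then traceL x = 4 x₀ + 2 tr y would be even after all.
    traceL-even : traceL c x ≡ trd c x ℤ.* + 2
    traceL-even with even-or-odd (traceL c x)
    ... | inj₁ even = even
    ... | inj₂ odd  = let t , t-even = even-coordinates⇒even-trace x even-coordinate in
                      ⊥-elim (odd≢even H t (trans (sym odd) t-even))
      where
      H : ℤ
      H = traceL c x ℤ./ + 2
      even-coordinate : ∀ m → x (suc m) ≡ x (suc m) ℤ./ + 2 ℤ.* + 2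
      even-coordinate m with even-or-odd (x (suc m))
      ... | inj₁ even = even
      ... | inj₂ oddₘ = ⊥-elim (odd≢even (H ℤ.+ X ℤ.+ H ℤ.* X ℤ.* + 2) (mulℤ c x x (suc m)) (begin
        + 1 ℤ.+ (H ℤ.+ X ℤ.+ H ℤ.* X ℤ.* + 2) ℤ.* + 2    ≡⟨ odd*odd H X ⟩
        (+ 1 ℤ.+ H ℤ.* + 2) ℤ.* (+ 1 ℤ.+ X ℤ.* + 2)      ≡⟨ cong₂ ℤ._*_ odd oddₘ ⟨
        traceL c x ℤ.* x (suc m)                          ≡⟨ twice-square m ⟨
        mulℤ c x x (suc m) ℤ.* + 2                        ∎))
        where
        X : ℤ
        X = x (suc m) ℤ./ + 2
        odd*odd : ∀ H X → + 1 ℤ.+ (H ℤ.+ X ℤ.+ H ℤ.* X ℤ.* + 2) ℤ.* + 2 ≡ (+ 1 ℤ.+ H ℤ.* + 2) ℤ.* (+ 1 ℤ.+ X ℤ.* + 2)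
        odd*odd = solve-∀

    fromℤ-trd : fromℤ (trd c x) ≡ q 0F + q 0F
    fromℤ-trd = *-cancelˡ-≡ (1ℚ + 1ℚ) (fromℤ (trd c x)) (q 0F + q 0F) {{ℚ.≢-nonZero {1ℚ + 1ℚ} λ ()}} (begin
      (1ℚ + 1ℚ) * fromℤ (trd c x)       ≡⟨ ℚP.*-comm (1ℚ + 1ℚ) (fromℤ (trd c x)) ⟩
      fromℤ (trd c x) * (1ℚ + 1ℚ)       ≡⟨ fromℤ-* (trd c x) (+ 2) ⟨
      fromℤ (trd c x ℤ.* + 2)           ≡⟨ cong fromℤ traceL-even ⟨
      fromℤ (traceL c x)                ≡⟨ fromℤ-traceL ⟩
      (q 0F + q 0F) + (q 0F + q 0F)     ≡⟨ double (q 0F + q 0F) ⟩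
      (1ℚ + 1ℚ) * (q 0F + q 0F)         ∎)
      where
      double : ∀ t → t + t ≡ (1ℚ + 1ℚ) * t
      double = RingSolver.solve-∀ ℚ-ring

    fromℤ-nrd : fromℤ (nrd c x) ≡ norm q
    fromℤ-nrd = begin
      fromℤ (trd c x ℤ.* x f0 ℤ.- mulℤ c x x f0)
        ≡⟨ fromℤ-minus (trd c x ℤ.* x f0) (mulℤ c x x f0) ⟩
      fromℤ (trd c x ℤ.* x f0) + - fromℤ (mulℤ c x x f0)
        ≡⟨ cong₂ (λ s t → s + - t) (trans (fromℤ-* (trd c x) (x f0)) (cong (_* fromℤ (x f0)) fromℤ-trd)) (fromℤ-square f0) ⟩
      (q 0F + q 0F) * fromℤ (x f0) + - ((q 0F + q 0F) * fromℤ (x f0) + - (norm q * 1ℚ))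
        ≡⟨ cancel ((q 0F + q 0F) * fromℤ (x f0)) (norm q) ⟩
      norm q ∎
      where
      cancel : ∀ s N → s + - (s + - (N * 1ℚ)) ≡ N
      cancel = RingSolver.solve-∀ ℚ-ring

    quadratic : mulℤ c x x ≐ (trd c x ℤᵛ.• x ℤᵛ.⊕ ℤᵛ.⊝ (nrd c x ℤᵛ.• oneℤ))
    quadratic m = fromℤ-injective (begin
      fromℤ (mulℤ c x x m)
        ≡⟨ fromℤ-square m ⟩
      (q 0F + q 0F) * fromℤ (x m) + - (norm q * fromℤ (oneℤ m))
        ≡⟨ cong₂ (λ s t → s * fromℤ (x m) + - (t * fromℤ (oneℤ m))) fromℤ-trd fromℤ-nrd ⟨
      fromℤ (trd c x) * fromℤ (x m) + - (fromℤ (nrd c x) * fromℤ (oneℤ m))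
        ≡⟨ cong₂ (λ s t → s + - t) (fromℤ-* (trd c x) (x m)) (fromℤ-* (nrd c x) (oneℤ m)) ⟨
      fromℤ (trd c x ℤ.* x m) + - fromℤ (nrd c x ℤ.* oneℤ m)
        ≡⟨ fromℤ-minus (trd c x ℤ.* x m) (nrd c x ℤ.* oneℤ m) ⟨
      fromℤ (trd c x ℤ.* x m ℤ.- nrd c x ℤ.* oneℤ m) ∎)

  quadratic-relation : ∀ x → mulℤ c x x ≐ (trd c x ℤᵛ.• x ℤᵛ.⊕ ℤᵛ.⊝ (nrd c x ℤᵛ.• oneℤ))
  quadratic-relation x = let q , x≐q = coordinates (embed x) in Integral.quadratic x q x≐q

  nrd-∙ : ∀ x y → nrd c (mulℤ c x y) ≡ nrd c x ℤ.* nrd c y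
  nrd-∙ x y = multiplicative (coordinates (embed x)) (coordinates (embed y))
    where
    multiplicative : (∃ λ q → embed x ≐ lc q) → (∃ λ r → embed y ≐ lc r) → nrd c (mulℤ c x y) ≡ nrd c x ℤ.* nrd c y
    multiplicative (q , x≐q) (r , y≐r) = fromℤ-injective (begin
      fromℤ (nrd c (mulℤ c x y))          ≡⟨ Integral.fromℤ-nrd (mulℤ c x y) (q ⋆ r) xy≐q⋆r ⟩
      norm (q ⋆ r)                        ≡⟨ norm-⋆ q r ⟩
      norm q * norm r                     ≡⟨ cong₂ _*_ (Integral.fromℤ-nrd x q x≐q) (Integral.fromℤ-nrd y r y≐r) ⟨
      fromℤ (nrd c x) * fromℤ (nrd c y)   ≡⟨ fromℤ-* (nrd c x) (nrd c y) ⟨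
      fromℤ (nrd c x ℤ.* nrd c y)         ∎)
      where
      xy≐q⋆r : embed (mulℤ c x y) ≐ lc (q ⋆ r)
      xy≐q⋆r m = begin
        embed (mulℤ c x y) m          ≡⟨ embed-∙ x y m ⟩
        mulℚ c (embed x) (embed y) m  ≡⟨ ℚᴬ.∙-congˡ (embed y) x≐q m ⟩
        mulℚ c (lc q) (embed y) m     ≡⟨ ℚᴬ.∙-congʳ (lc q) y≐r m ⟩
        mulℚ c (lc q) (lc r) m        ≡⟨ lc-∙ q r m ⟩
        lc (q ⋆ r) m                  ∎

module ReducedNorm (c : StructConst) (isQuaternionOrder : IsQuaternionOrder c) where

  open import Data.Integer using (+_; _+_; _*_; _-_; -_)

  open IsQuaternionOrder isQuaternionOrder
  open QuaternionOrder c isQuaternionOrder using (quadratic-relation; nrd-∙)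
  open ≡-Reasoning
  module ℤᴬ = ℤᵛ.Algebra c

  conj : V4 ℤ → V4 ℤ
  conj x = trd c x ℤᵛ.• oneℤ ℤᵛ.⊕ ℤᵛ.⊝ x

  private
    s-[s-n]≡n : ∀ s n → s + - (s + - n) ≡ n
    s-[s-n]≡n = solve-∀

  ∙-conj : ∀ x → mulℤ c x (conj x) ≐ (nrd c x ℤᵛ.• oneℤ)
  ∙-conj x m = begin
    mulℤ c x (conj x) m                             ≡⟨ ℤᴬ.∙-distribˡ-⊕ x (t ℤᵛ.• oneℤ) (ℤᵛ.⊝ x) m ⟩
    mulℤ c x (t ℤᵛ.• oneℤ) m + mulℤ c x (ℤᵛ.⊝ x) m  ≡⟨ cong₂ _+_ (ℤᴬ.∙-scaleʳ t x oneℤ m) (ℤᴬ.∙-negʳ x x m) ⟩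
    t * mulℤ c x oneℤ m - mulℤ c x x m              ≡⟨ cong₂ (λ s u → t * s - u) (unitʳ x m) (quadratic-relation x m) ⟩
    t * x m - (t * x m - nrd c x * oneℤ m)          ≡⟨ s-[s-n]≡n (t * x m) (nrd c x * oneℤ m) ⟩
    nrd c x * oneℤ m                                ∎
    where
    t : ℤ
    t = trd c x

  conj-∙ : ∀ x → mulℤ c (conj x) x ≐ (nrd c x ℤᵛ.• oneℤ)
  conj-∙ x m = begin
    mulℤ c (conj x) x m                             ≡⟨ ℤᴬ.∙-distribʳ-⊕ (t ℤᵛ.• oneℤ) (ℤᵛ.⊝ x) x m ⟩
    mulℤ c (t ℤᵛ.• oneℤ) x m + mulℤ c (ℤᵛ.⊝ x) x m  ≡⟨ cong₂ _+_ (ℤᴬ.∙-scaleˡ t oneℤ x m) (ℤᴬ.∙-negˡ x x m) ⟩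
    t * mulℤ c oneℤ x m - mulℤ c x x m              ≡⟨ cong₂ (λ s u → t * s - u) (unitˡ x m) (quadratic-relation x m) ⟩
    t * x m - (t * x m - nrd c x * oneℤ m)          ≡⟨ s-[s-n]≡n (t * x m) (nrd c x * oneℤ m) ⟩
    nrd c x * oneℤ m                                ∎
    where
    t : ℤ
    t = trd c x

  nrd-cong : ∀ {x y} → x ≐ y → nrd c x ≡ nrd c y
  nrd-cong {x} {y} x≐y = cong₂ _-_
    (cong₂ _*_ (cong (ℤ._/ + 2) (ℤᴬ.tr-cong x≐y)) (x≐y f0))
    (trans (ℤᴬ.∙-congˡ x x≐y f0) (ℤᴬ.∙-congʳ y x≐y f0))

  nrd-oneℤ : nrd c oneℤ ≡ 1ℤ
  nrd-oneℤ = cong₂ (λ t s → t ℤ./ + 2 * 1ℤ - s) (ℤᴬ.tr-e₀ unitˡ) (unitˡ oneℤ f0)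

  unit-nonzero : ∀ u v → mulℤ c u v ≐ oneℤ → ¬ (u ≐ zeroℤ)
  unit-nonzero u v uv≐1 u≐0 with trans (sym (uv≐1 f0)) (ℤᴬ.∙-congˡ v u≐0 f0)
  ... | ()

  nrd-unit : IsDefinite c → ∀ u → IsUnitO c u → nrd c u ≡ 1ℤ
  nrd-unit definite u (v , uv≐1 , vu≐1) =
    positive-product≡1 (definite u (unit-nonzero u v uv≐1)) (definite v (unit-nonzero v u vu≐1)) (begin
      nrd c u * nrd c v    ≡⟨ nrd-∙ u v ⟨
      nrd c (mulℤ c u v)   ≡⟨ nrd-cong uv≐1 ⟩
      nrd c oneℤ           ≡⟨ nrd-oneℤ ⟩
      1ℤ                   ∎)

prime∤⇒coprime : ∀ {p n} → Prime p → ¬ (p ∣ n) → Coprime p n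
prime∤⇒coprime p-prime p∤n (d∣p , d∣n) with prime⇒irreducible p-prime d∣p
... | inj₁ d≡1    = d≡1
... | inj₂ refl   = ⊥-elim (p∤n d∣n)

module ScalarUnits (m : ℕ) where

  open import Data.Integer using (+_; _+_; _*_; _-_; -_)

  signed : ∀ i → + m Unsigned.∣ i → + m ∣ℤ i
  signed i = ∣ᵤ⇒∣ {+ m} {i}

  unit-mod : ∀ a b → + m ∣ℤ a * b - 1ℤ → ScalarUnitMod m a
  unit-mod a b m∣ab-1 = b , ∣⇒∣ᵤ m∣ab-1

  coprime⇒unit-mod : ∀ {a} → Coprime a m → ScalarUnitMod m (+ a)
  coprime⇒unit-mod {a} coprime with coprime-Bézout coprime
  ... | Bézout.+- x y 1+ym≡xa = unit-mod (+ a) (+ x) (divides (+ y) (begin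
    + a * + x - 1ℤ             ≡⟨ cong (_- 1ℤ) (ℤP.*-comm (+ a) (+ x)) ⟩
    + x * + a - 1ℤ             ≡⟨ cong (_- 1ℤ) (ℤP.pos-* x a) ⟨
    + (x ℕ.* a) - 1ℤ           ≡⟨ cong (λ t → + t - 1ℤ) 1+ym≡xa ⟨
    1ℤ + + (y ℕ.* m) - 1ℤ      ≡⟨ cong (λ t → 1ℤ + t - 1ℤ) (ℤP.pos-* y m) ⟩
    1ℤ + + y * + m - 1ℤ        ≡⟨ 1+t-1≡t (+ y * + m) ⟩
    + y * + m                  ∎))
    where
    open ≡-Reasoning
    1+t-1≡t : ∀ t → 1ℤ + t - 1ℤ ≡ t
    1+t-1≡t = solve-∀
  ... | Bézout.-+ x y 1+xa≡ym = unit-mod (+ a) (- + x) (divides (- + y) (begin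
    + a * - + x - 1ℤ           ≡⟨ rearrange (+ a) (+ x) ⟩
    - (1ℤ + + x * + a)         ≡⟨ cong (λ t → - (1ℤ + t)) (ℤP.pos-* x a) ⟨
    - + (1 ℕ.+ x ℕ.* a)        ≡⟨ cong (λ t → - + t) 1+xa≡ym ⟩
    - + (y ℕ.* m)              ≡⟨ cong -_ (ℤP.pos-* y m) ⟩
    - (+ y * + m)              ≡⟨ ℤP.neg-distribˡ-* (+ y) (+ m) ⟩
    - + y * + m                ∎))
    where
    open ≡-Reasoning
    rearrange : ∀ a x → a * - x - 1ℤ ≡ - (1ℤ + x * a)
    rearrange = solve-∀

  unit-mod-* : ∀ a b → ScalarUnitMod m a → ScalarUnitMod m b → ScalarUnitMod m (a * b)
  unit-mod-* a b (a′ , m∣aa′-1) (b′ , m∣bb′-1) = unit-mod (a * b) (a′ * b′) (subst (+ m ∣ℤ_) (regroup a a′ b b′)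
    (∣m∣n⇒∣m+n (∣m⇒∣m*n (b * b′) (signed (a * a′ - 1ℤ) m∣aa′-1)) (signed (b * b′ - 1ℤ) m∣bb′-1)))
    where
    regroup : ∀ a a′ b b′ → (a * a′ - 1ℤ) * (b * b′) + (b * b′ - 1ℤ) ≡ a * b * (a′ * b′) - 1ℤ
    regroup = solve-∀

  unit-mod-inverse : ∀ a → ((b , _) : ScalarUnitMod m a) → ScalarUnitMod m b
  unit-mod-inverse a (b , m∣ab-1) = a , subst (λ t → + m Unsigned.∣ t - 1ℤ) (ℤP.*-comm a b) m∣ab-1

  unit-mod-neg : ∀ a → ScalarUnitMod m a → ScalarUnitMod m (- a)
  unit-mod-neg a (b , m∣ab-1) = - b , subst (λ t → + m Unsigned.∣ t - 1ℤ) (neg*neg a b) m∣ab-1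
    where
    neg*neg : ∀ a b → a * b ≡ - a * - b
    neg*neg = solve-∀

  unit-mod-^ : ∀ {p} → ScalarUnitMod m (+ p) → ∀ k → ScalarUnitMod m (+ (p ℕ.^ k))
  unit-mod-^     p-unit zero    = unit-mod 1ℤ 1ℤ (divides 0ℤ refl)
  unit-mod-^ {p} p-unit (suc k) =
    subst (ScalarUnitMod m) (sym (ℤP.pos-* p (p ℕ.^ k))) (unit-mod-* (+ p) (+ (p ℕ.^ k)) p-unit (unit-mod-^ p-unit k))

module Congruences (c : StructConst) (isQuaternionOrder : IsQuaternionOrder c) (m : ℕ) where

  open import Data.Integer using (+_; _+_; _*_; _-_; -_)

  open IsQuaternionOrder isQuaternionOrder
  open ReducedNorm c isQuaternionOrder using (conj; ∙-conj; conj-∙)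
  open ScalarUnits m
  module ℤᴬ = ℤᵛ.Algebra c
  open ≡-Reasoning

  ∣-∙ʳ : ∀ v d → (∀ j → + m ∣ℤ d j) → ∀ k → + m ∣ℤ mulℤ c v d k
  ∣-∙ʳ v d m∣d k = subst (+ m ∣ℤ_) (sym (ℤᴬ.∙-columns v d k))
    (∣m∣n⇒∣m+n (∣m∣n⇒∣m+n (∣m∣n⇒∣m+n (term f0) (term f1)) (term f2)) (term f3))
    where
    term : ∀ j → + m ∣ℤ d j * mulℤ c v (ℤᴬ.e j) k
    term j = ∣m⇒∣m*n (mulℤ c v (ℤᴬ.e j) k) (m∣d j)

  scaled⇒~m : ∀ α β {γ u} → ScalarUnitMod m α → ScalarUnitMod m β → (∀ k → α * γ k ≡ β * u k) → _~m_ c m γ u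
  scaled⇒~m α β {γ} {u} (α′ , m∣αα′-1) β-unit αγ≡βu =
    α′ * β , unit-mod-* α′ β (unit-mod-inverse α (α′ , m∣αα′-1)) β-unit , λ k →
    ∣⇒∣ᵤ (subst (+ m ∣ℤ_) (eq k) (∣m⇒∣m*n (- γ k) (signed (α * α′ - 1ℤ) m∣αα′-1)))
    where
    eq : ∀ k → (α * α′ - 1ℤ) * - γ k ≡ γ k - α′ * β * u k
    eq k = begin
      (α * α′ - 1ℤ) * - γ k   ≡⟨ expand α α′ (γ k) ⟩
      γ k - α′ * (α * γ k)    ≡⟨ cong (λ t → γ k - α′ * t) (αγ≡βu k) ⟩
      γ k - α′ * (β * u k)    ≡⟨ cong (λ t → γ k - t) (ℤP.*-assoc α′ β (u k)) ⟨
      γ k - α′ * β * u k      ∎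
      where
      expand : ∀ α α′ g → (α * α′ - 1ℤ) * - g ≡ g - α′ * (α * g)
      expand = solve-∀

  ≈p⇒~m : ∀ {p γ u} → ScalarUnitMod m (+ p) → _≈p_ c p γ u → _~m_ c m γ u
  ≈p⇒~m {p} p-unit (s , t , inj₁ pˢγ≐pᵗu) =
    scaled⇒~m (+ (p ℕ.^ s)) (+ (p ℕ.^ t)) (unit-mod-^ p-unit s) (unit-mod-^ p-unit t) pˢγ≐pᵗu
  ≈p⇒~m {p} {γ} {u} p-unit (s , t , inj₂ pˢγ≐-pᵗu) =
    scaled⇒~m (+ (p ℕ.^ s)) (- + (p ℕ.^ t)) (unit-mod-^ p-unit s) (unit-mod-neg (+ (p ℕ.^ t)) (unit-mod-^ p-unit t))
      λ k → trans (pˢγ≐-pᵗu k) (ℤP.neg-distribˡ-* (+ (p ℕ.^ t)) (u k))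

  ~m-sym : ∀ x y → _~m_ c m x y → _~m_ c m y x
  ~m-sym x y (a , (a′ , m∣aa′-1) , x≡ay) = a′ , unit-mod-inverse a (a′ , m∣aa′-1) , λ k →
    ∣⇒∣ᵤ (subst (+ m ∣ℤ_) (regroup a a′ (x k) (y k))
      (∣m∣n⇒∣m+n (∣m⇒∣m*n (- y k) (signed (a * a′ - 1ℤ) m∣aa′-1)) (∣n⇒∣m*n (- a′) (signed (x k - a * y k) (x≡ay k)))))
    where
    regroup : ∀ a a′ x y → (a * a′ - 1ℤ) * - y + - a′ * (x - a * y) ≡ y - a′ * x
    regroup = solve-∀

  ~m-∙ˡ : ∀ v x y → _~m_ c m x y → _~m_ c m (mulℤ c v x) (mulℤ c v y)
  ~m-∙ˡ v x y (a , a-unit , x≡ay) = a , a-unit , λ k →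
    ∣⇒∣ᵤ (subst (+ m ∣ℤ_) (linear k) (∣-∙ʳ v (x ℤᵛ.⊕ ℤᵛ.⊝ (a ℤᵛ.• y)) (λ j → signed (x j - a * y j) (x≡ay j)) k))
    where
    linear : ∀ k → mulℤ c v (x ℤᵛ.⊕ ℤᵛ.⊝ (a ℤᵛ.• y)) k ≡ mulℤ c v x k - a * mulℤ c v y k
    linear k = begin
      mulℤ c v (x ℤᵛ.⊕ ℤᵛ.⊝ (a ℤᵛ.• y)) k                   ≡⟨ ℤᴬ.∙-distribˡ-⊕ v x (ℤᵛ.⊝ (a ℤᵛ.• y)) k ⟩
      mulℤ c v x k + mulℤ c v (ℤᵛ.⊝ (a ℤᵛ.• y)) k          ≡⟨ cong (λ t → mulℤ c v x k + t) (ℤᴬ.∙-negʳ v (a ℤᵛ.• y) k) ⟩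
      mulℤ c v x k - mulℤ c v (a ℤᵛ.• y) k                 ≡⟨ cong (λ t → mulℤ c v x k - t) (ℤᴬ.∙-scaleʳ a v y k) ⟩
      mulℤ c v x k - a * mulℤ c v y k                      ∎

  ~m-respʳ : ∀ x {y z} → _~m_ c m x y → y ≐ z → _~m_ c m x z
  ~m-respʳ x (a , a-unit , x≡ay) y≐z = a , a-unit , λ k → subst (λ t → + m Unsigned.∣ x k - a * t) (y≐z k) (x≡ay k)

  unit-norm⇒unit-mod : ∀ γ → ScalarUnitMod m (nrd c γ) → IsUnitMod c m γ
  unit-norm⇒unit-mod γ (b , m∣nb-1) =
    b ℤᵛ.• conj γ , inverse (∙-conj γ) (ℤᴬ.∙-scaleʳ b γ (conj γ)) , inverse (conj-∙ γ) (ℤᴬ.∙-scaleˡ b (conj γ) γ)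
    where
    inverse : ∀ {y z} → y ≐ (nrd c γ ℤᵛ.• oneℤ) → z ≐ (b ℤᵛ.• y) → z ≡[ m ] oneℤ
    inverse {y} {z} y≐n z≐by k = ∣⇒∣ᵤ (subst (+ m ∣ℤ_) eq (∣m⇒∣m*n (oneℤ k) (signed (nrd c γ * b - 1ℤ) m∣nb-1)))
      where
      eq : (nrd c γ * b - 1ℤ) * oneℤ k ≡ z k - oneℤ k
      eq = begin
        (nrd c γ * b - 1ℤ) * oneℤ k     ≡⟨ regroup (nrd c γ) b (oneℤ k) ⟩
        b * (nrd c γ * oneℤ k) - oneℤ k ≡⟨ cong (λ t → b * t - oneℤ k) (y≐n k) ⟨
        b * y k - oneℤ k                ≡⟨ cong (_- oneℤ k) (z≐by k) ⟨
        z k - oneℤ k                    ∎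
        where
        regroup : ∀ n b o → (n * b - 1ℤ) * o ≡ b * (n * o) - o
        regroup = solve-∀

module _ (c : StructConst) (p : ℕ) where

  open import Data.Integer using (+_; _*_; -_)

  private
    pᵗ : ℕ → ℤ
    pᵗ t = + (p ℕ.^ t)

  ≐⇒≈p : ∀ {γ δ} → γ ≐ δ → _≈p_ c p γ δ
  ≐⇒≈p γ≐δ = 0 , 0 , inj₁ λ k → cong (1ℤ *_) (γ≐δ k)

  ≈p-resp-± : ∀ {γ u v} → _≈p_ c p γ u → (u ≐ v) ⊎ (u ≐ negℤ v) → _≈p_ c p γ v
  ≈p-resp-± (s , t , inj₁ pˢγ≐pᵗu)  (inj₁ u≐v)  = s , t , inj₁ λ k → trans (pˢγ≐pᵗu k) (cong (pᵗ t *_) (u≐v k))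
  ≈p-resp-± (s , t , inj₁ pˢγ≐pᵗu)  (inj₂ u≐-v) = s , t , inj₂ λ k →
    trans (pˢγ≐pᵗu k) (trans (cong (pᵗ t *_) (u≐-v k)) (sym (ℤP.neg-distribʳ-* (pᵗ t) _)))
  ≈p-resp-± (s , t , inj₂ pˢγ≐-pᵗu) (inj₁ u≐v)  = s , t , inj₂ λ k → trans (pˢγ≐-pᵗu k) (cong (λ w → - (pᵗ t * w)) (u≐v k))
  ≈p-resp-± (s , t , inj₂ pˢγ≐-pᵗu) (inj₂ u≐-v) = s , t , inj₁ λ k →
    trans (pˢγ≐-pᵗu k) (trans (cong (λ w → - (pᵗ t * w)) (u≐-v k)) (-[a*-b]≡a*b (pᵗ t) _))
    where
    -[a*-b]≡a*b : ∀ a b → - (a * - b) ≡ a * b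
    -[a*-b]≡a*b = solve-∀

module ComplementarySubgroups
  (p : ℕ) (p-prime : Prime p) (c : StructConst) (isQuaternionOrder : IsQuaternionOrder c) (definite : IsDefinite c)
  (m : ℕ) (H : V4 ℤ → Set) (congruence-pair : IsCongruencePair c m H) (p∤m : ¬ (p ∣ m))
  where

  open import Data.Integer using (+_)

  open IsQuaternionOrder isQuaternionOrder
  open IsCongruencePair congruence-pair
  open IsSubgroupG subgroup
  open QuaternionOrder c isQuaternionOrder using (nrd-∙)
  open ReducedNorm c isQuaternionOrder using (nrd-unit)
  open ScalarUnits m
  open Congruences c isQuaternionOrder m

  p-unit : ScalarUnitMod m (+ p)
  p-unit = coprime⇒unit-mod (prime∤⇒coprime p-prime p∤m)

  oneℤ-unit : IsUnitO c oneℤ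
  oneℤ-unit = oneℤ , unitˡ oneℤ , unitˡ oneℤ

  cancel-unitˡ : ∀ u v → mulℤ c v u ≐ oneℤ → ∀ x → mulℤ c v (mulℤ c u x) ≐ x
  cancel-unitˡ u v vu≐1 x k = trans (sym (assoc v u x k)) (trans (ℤᴬ.∙-congˡ x vu≐1 k) (unitˡ x k))

  trivial-intersection : ∀ γ → InGZ c p γ → InΛ c p H γ → _≈p_ c p γ oneℤ
  trivial-intersection γ (u , u-unit , γ≈u) (_ , Hγ) = ≈p-resp-± c p γ≈u (injective u oneℤ u-unit oneℤ-unit u~1)
    where
    u~1 : _~m_ c m u oneℤ
    u~1 = trivInter u u-unit (wellDef γ u Hγ (≈p⇒~m p-unit γ≈u))

  factorisation : ∀ γ → InGp c p γ → ∃ λ u → ∃ λ δ → InGZ c p u × InΛ c p H δ × _≈p_ c p γ (mulℤ c u δ)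
  factorisation γ (k , nrdγ≡pᵏ) = factor (product γ γ-unit)
    where
    γ-unit : IsUnitMod c m γ
    γ-unit = unit-norm⇒unit-mod γ (subst (ScalarUnitMod m) (sym nrdγ≡pᵏ) (unit-mod-^ p-unit k))
    factor : (∃ λ u → ∃ λ h → IsUnitO c u × H h × _~m_ c m γ (mulℤ c u h)) →
             ∃ λ u → ∃ λ δ → InGZ c p u × InΛ c p H δ × _≈p_ c p γ (mulℤ c u δ)
    factor (u , h , u-unit@(v , uv≐1 , vu≐1) , Hh , γ~uh) =
      u , δ , (u , u-unit , ≐⇒≈p c p λ _ → refl) , ((k , nrdδ≡pᵏ) , Hδ) , ≐⇒≈p c p γ≐uδ
      where
      δ : V4 ℤ
      δ = mulℤ c v γ
      γ≐uδ : γ ≐ mulℤ c u δ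
      γ≐uδ l = sym (cancel-unitˡ v u uv≐1 γ l)
      nrdδ≡pᵏ : nrd c δ ≡ + (p ℕ.^ k)
      nrdδ≡pᵏ = trans (nrd-∙ v γ) (trans (cong₂ ℤ._*_ (nrd-unit definite v (u , vu≐1 , uv≐1)) nrdγ≡pᵏ) (ℤP.*-identityˡ (+ (p ℕ.^ k))))
      δ~h : _~m_ c m δ h
      δ~h = ~m-respʳ δ (~m-∙ˡ v γ (mulℤ c u h) γ~uh) (cancel-unitˡ u v vu≐1 h)
      Hδ : H δ
      Hδ = wellDef h δ Hh (~m-sym δ h δ~h)

-- Class number one, maximality and splitting at p are what identify 𝒢(ℤ[1/p]) with the elements of
-- 𝒪 of norm a power of p in the paper; here that description is built into InGp, so they are unused.
proposition3p4 :
    (p : ℕ) → Prime p →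
    (c : StructConst) → IsQuaternionOrder c → IsDefinite c → HasClassNumberOne c →
    SplitsAt c p → IsMaximalOrder c →
    (m : ℕ) (H : V4 ℤ → Set) → IsCongruencePair c m H → ¬ (p ∣ m) →
    (∀ γ → InGZ c p γ → InΛ c p H γ → _≈p_ c p γ oneℤ)
    × (∀ γ → InGp c p γ →
         ∃ λ u → ∃ λ δ → InGZ c p u × InΛ c p H δ × _≈p_ c p γ (mulℤ c u δ))
proposition3p4 p p-prime c isQuaternionOrder definite _ _ _ m H congruence-pair p∤m =
  trivial-intersection , factorisation
  where open ComplementarySubgroups p p-prime c isQuaternionOrder definite m H congruence-pair p∤m
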